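{- Let $B\in\mathrm{M}_3(\mathbb{R})$ be a real cluster-cyclic skew-symmetrizable matrix and $\mathbf w\in\mathcal T\setminus\{\emptyset\}$ with last index $k$. Let $s\in\{1,2,3\}\setminus\{k\}$ be the unique index with $\varepsilon_s^{\mathbf w}\mathrm{sign}(b_{ks}^{\mathbf w})=-1$ and $\varepsilon_k^{\mathbf w}\ne\varepsilon_s^{\mathbf w}$. (a) $\varepsilon_s^{\mathbf w}\big((|b_{sk}^{\mathbf w}b_{ks}^{\mathbf w}|-2)\mathbf c_k^{\mathbf w}+|b_{sk}^{\mathbf w}|\mathbf c_s^{\mathbf w}\big)\ge\mathbf 0$. (b) For any $k'\in\{1,2,3\}\setminus\{k\}$ and any $i\in\{1,2,3\}$, $\varepsilon_i^{\mathbf w}\mathbf c_i^{\mathbf w}\le\varepsilon_i^{\mathbf w[k']}\mathbf c_i^{\mathbf w[k']}$; moreover there exists $i\in\{1,2,3\}$ for which this inequality is not an equality.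
   Context: A matrix $B=(b_{ij})\in\mathrm{M}_3(\mathbb{R})$ is skew-symmetrizable if $DB$ is skew-symmetric for some positive diagonal $D$. Notation: $[a]_+=\max(a,0)$, entrywise on matrices; $J_k$ is diagonal with $k$th entry $-1$, others $1$; $A^{\bullet k}$ (resp. $A^{k\bullet}$) keeps only the $k$th column (resp. row) of $A$. Mutation: $\mu_k(B)=(J_k+[-B]_+^{\bullet k})B(J_k+[B]_+^{k\bullet})$. $\mathcal T$ is the set of reduced sequences $\mathbf w=[k_1,\dots,k_r]$ ($k_i\in\{1,2,3\}$, $k_i\ne k_{i+1}$), including $\emptyset$; $\mathbf w[k]$ appends $k$ if $\mathbf w=\emptyset$ or $k\ne k_r$, and deletes the last entry if $k=k_r$. $B^{\mathbf w}=\mu_{k_r}\cdots\mu_{k_1}(B)=(b_{ij}^{\mathbf w})$. $C^\emptyset=I$, $C^{\mathbf w[k]}=C^{\mathbf w}J_k+C^{\mathbf w}[B^{\mathbf w}]_+^{k\bullet}+[-C^{\mathbf w}]_+^{\bullet k}B^{\mathbf w}$, columns $\mathbf c_i^{\mathbf w}$. $\le$ on $\mathbb R^3$ is componentwise. $B$ is cyclic if $\mathrm{sign}(B)=\pm\begin{pmatrix}0&-1&1\\1&0&-1\\-1&1&0\end{pmatrix}$ entrywise; cluster-cyclic if every $B^{\mathbf w}$ is cyclic. For cluster-cyclic $B$ every $\mathbf c_i^{\mathbf w}$ is nonzero and componentwise $\ge0$ or $\le 0$, and the tropical sign $\varepsilon_i^{\mathbf w}\in\{\pm1\}$ satisfies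 $\varepsilon_i^{\mathbf w}\mathbf c_i^{\mathbf w}\ge\mathbf 0$; the index $s$ in the statement exists and is unique. -}

module Defs where

open import Data.Nat using (ℕ)
open import Data.Fin using (Fin; zero; suc)
open import Data.Fin.Properties using (_≟_)
open import Data.List using (List; []; _∷_; _∷ʳ_; foldl)
open import Data.Product using (Σ; ∃; _×_; _,_)
open import Data.Sum using (_⊎_)
open import Data.Unit using (⊤)
open import Relation.Nullary using (¬_; yes; no)
open import Relation.Binary.PropositionalEquality using (_≡_; _≢_)
open import Relation.Binary.Definitions using (Trichotomous; Transitive; tri<; tri≈; tri>)
open import Level using (0ℓ)

-- An abstract model of the real numbers: a Dedekind-complete ordered
-- field (axiomatised up to propositional equality).  Every such
-- structure is (classically) isomorphic to ℝ, so quantifying over all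
-- of them is the same as speaking about ℝ.

record RealField : Set₁ where
  infixl 6 _+_
  infixl 7 _*_
  infix  4 _<_
  field
    Carrier : Set
    0# 1#   : Carrier
    _+_ _*_ : Carrier → Carrier → Carrier
    -_      : Carrier → Carrier
    _<_     : Carrier → Carrier → Set
    +-assoc     : ∀ x y z → (x + y) + z ≡ x + (y + z)
    +-comm      : ∀ x y → x + y ≡ y + x
    +-identityˡ : ∀ x → 0# + x ≡ x
    -‿inverseˡ  : ∀ x → (- x) + x ≡ 0#
    *-assoc     : ∀ x y z → (x * y) * z ≡ x * (y * z)
    *-comm      : ∀ x y → x * y ≡ y * x
    *-identityˡ : ∀ x → 1# * x ≡ x
    distribˡ    : ∀ x y z → x * (y + z) ≡ x * y + x * z
    0≢1         : 0# ≢ 1#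
    *-inverse   : ∀ x → x ≢ 0# → ∃ λ y → x * y ≡ 1#
    <-trans     : Transitive _<_
    compare     : Trichotomous _≡_ _<_
    +-mono-<    : ∀ {x y} z → x < y → x + z < y + z
    *-pos       : ∀ {x y} → 0# < x → 0# < y → 0# < x * y
    sup : (P : Carrier → Set) → (∃ λ x → P x) →
          (∃ λ u → ∀ x → P x → ¬ (u < x)) →
          ∃ λ s → (∀ x → P x → ¬ (s < x)) ×
                  (∀ u → (∀ x → P x → ¬ (u < x)) → ¬ (u < s))

data Sgn : Set where
  neg zer pos : Sgn

data PM : Set where
  plus minus : PM

cycPat : Fin 3 → Fin 3 → Sgn
cycPat zero zero = zer
cycPat zero (suc zero) = neg
cycPat zero (suc (suc zero)) = pos
cycPat (suc zero) zero = pos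
cycPat (suc zero) (suc zero) = zer
cycPat (suc zero) (suc (suc zero)) = neg
cycPat (suc (suc zero)) zero = neg
cycPat (suc (suc zero)) (suc zero) = pos
cycPat (suc (suc zero)) (suc (suc zero)) = zer

flipSgn : Sgn → Sgn
flipSgn neg = pos
flipSgn zer = zer
flipSgn pos = neg

-- Reduced sequences in T (lists over {1,2,3} = Fin 3, first entry = k₁)

Reduced : List (Fin 3) → Set
Reduced [] = ⊤
Reduced (x ∷ []) = ⊤
Reduced (x ∷ y ∷ l) = x ≢ y × Reduced (y ∷ l)

extend : List (Fin 3) → Fin 3 → List (Fin 3)
extend [] k = k ∷ []
extend (x ∷ []) k with x ≟ k
... | yes _ = []
... | no _  = x ∷ k ∷ []
extend (x ∷ y ∷ l) k = x ∷ extend (y ∷ l) k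

module RealDefs (ℝ : RealField) where
  open RealField ℝ public

  R = Carrier

  infixl 6 _-_
  _-_ : R → R → R
  x - y = x + (- y)

  infix 4 _≤_
  _≤_ : R → R → Set
  x ≤ y = x < y ⊎ x ≡ y

  2# : R
  2# = 1# + 1#

  max0 : R → R
  max0 a with compare a 0#
  ... | tri< _ _ _ = 0#
  ... | tri≈ _ _ _ = 0#
  ... | tri> _ _ _ = a

  ∣_∣ : R → R
  ∣ a ∣ with compare a 0#
  ... | tri< _ _ _ = - a
  ... | tri≈ _ _ _ = a
  ... | tri> _ _ _ = a

  sgn : R → Sgn
  sgn a with compare a 0#
  ... | tri< _ _ _ = neg
  ... | tri≈ _ _ _ = zer
  ... | tri> _ _ _ = pos

  sgnR : R → R
  sgnR a with compare a 0#
  ... | tri< _ _ _ = - 1#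
  ... | tri≈ _ _ _ = 0#
  ... | tri> _ _ _ = 1#

  pmR : PM → R
  pmR plus = 1#
  pmR minus = - 1#

  Vec3 : Set
  Vec3 = Fin 3 → R

  Mat : Set
  Mat = Fin 3 → Fin 3 → R

  sum3 : (Fin 3 → R) → R
  sum3 f = f zero + f (suc zero) + f (suc (suc zero))

  _⊗_ : Mat → Mat → Mat
  (A ⊗ B) i j = sum3 λ l → A i l * B l j

  _⊕_ : Mat → Mat → Mat
  (A ⊕ B) i j = A i j + B i j

  negM : Mat → Mat
  negM A i j = - A i j

  posM : Mat → Mat
  posM A i j = max0 (A i j)

  colOnly : Fin 3 → Mat → Mat
  colOnly k A i j with j ≟ k
  ... | yes _ = A i j
  ... | no _  = 0#

  rowOnly : Fin 3 → Mat → Mat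
  rowOnly k A i j with i ≟ k
  ... | yes _ = A i j
  ... | no _  = 0#

  Id : Mat
  Id i j with i ≟ j
  ... | yes _ = 1#
  ... | no _  = 0#

  J : Fin 3 → Mat
  J k i j with i ≟ j | i ≟ k
  ... | yes _ | yes _ = - 1#
  ... | yes _ | no _  = 1#
  ... | no _  | _     = 0#

  μ : Fin 3 → Mat → Mat
  μ k B = ((J k ⊕ colOnly k (posM (negM B))) ⊗ B) ⊗ (J k ⊕ rowOnly k (posM B))

  step : Mat × Mat → Fin 3 → Mat × Mat
  step (B , C) k =
    μ k B , ((C ⊗ J k) ⊕ (C ⊗ rowOnly k (posM B))) ⊕ (colOnly k (posM (negM C)) ⊗ B)

  BC : Mat → List (Fin 3) → Mat × Mat
  BC B w = foldl step (B , Id) w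

  Bw : Mat → List (Fin 3) → Mat
  Bw B w = Σ.proj₁ (BC B w)

  Cw : Mat → List (Fin 3) → Mat      -- C^w ; column i is c_i^w
  Cw B w = Σ.proj₂ (BC B w)

  SkewSymmetrizable : Mat → Set
  SkewSymmetrizable B =
    ∃ λ (d : Fin 3 → R) → (∀ i → 0# < d i) × (∀ i j → d i * B i j ≡ - (d j * B j i))

  Cyclic : Mat → Set
  Cyclic B = (∀ i j → sgn (B i j) ≡ cycPat i j) ⊎ (∀ i j → sgn (B i j) ≡ flipSgn (cycPat i j))

  ClusterCyclic : Mat → Set
  ClusterCyclic B = ∀ w → Reduced w → Cyclic (Bw B w)

  TropSigns : Mat → List (Fin 3) → (Fin 3 → PM) → Set
  TropSigns B w ε = ∀ i j → 0# ≤ pmR (ε i) * Cw B w j i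

-- Along a reduced sequence w ending in k, the pair (B^w, C^w) carries an invariant: tropical
-- signs ε for which every column of C^w is sign-coherent and nonzero, and an index s ≠ k with
-- εₖ = -εₛ, sign bₖₛ = -εₛ, and the vector of (a) nonnegative and nonzero.  Mutating at k' ≠ k
-- preserves it.  At the third index t, whichever of cₛ, cₖ has the tropical sign of cₜ absorbs a
-- nonnegative multiple of cₜ.  At s, cₖ grows by the old vector of (a) plus (|bₛₖbₖₛ| - 4) εₖcₖ,
-- and |bₛₖ| times the new vector of (a) is a nonnegative combination of the same quantities.
-- The bound |bₛₖbₖₛ| ≥ 4 comes from cluster-cyclicity: mutating alternately at s and k turns
-- aₙ = |bₛₜ| into a positive solution of aₙ₊₂ = (|bₛₖbₖₛ| - 2) aₙ₊₁ - aₙ, impossible by the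
-- Archimedean property when the coefficient is below 2.  In every step the signed c-vectors
-- weakly grow and one of them strictly, which is (b).

module Submission where

open import Defs
open import Data.Nat as ℕ using (ℕ)
open import Data.Integer as ℤ using (ℤ; -[1+_])
import Data.Integer.Properties as ℤ
open import Data.Nat.Properties using (+-suc)
open import Data.Sign as Sign using (Sign)
open import Data.Fin using (Fin)
open import Data.Fin.Patterns using (0F; 1F; 2F)
open import Data.Fin.Properties using (_≟_)
open import Data.List using (List; []; _∷_; _∷ʳ_)
open import Data.List.Properties using (foldl-∷ʳ)
open import Data.List.Reverse using (Reverse; reverseView; []; _∶_∶ʳ_)
open import Data.Maybe as Maybe using ()
open import Data.Product using (Σ; ∃; _×_; _,_; proj₁; proj₂)
open import Data.Sum using (_⊎_; inj₁; inj₂)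
open import Data.Empty using (⊥-elim)
open import Relation.Nullary using (¬_; yes; no)
open import Relation.Nullary.Decidable.Core using (dec⇒maybe)
open import Relation.Binary.Definitions using (tri<; tri≈; tri>)
open import Relation.Binary.PropositionalEquality
  using (_≡_; _≢_; refl; sym; trans; cong; cong₂; subst; subst₂; isEquivalence; module ≡-Reasoning)
open import Algebra.Bundles using (CommutativeRing; RawRing)
open import Algebra.Solver.Ring.AlmostCommutativeRing
  using (fromCommutativeRing; _-Raw-AlmostCommutative⟶_)

flipPM : PM → PM
flipPM plus  = minus
flipPM minus = plus

pmS : PM → Sgn
pmS plus  = pos
pmS minus = neg

≡⊎≡flipPM : ∀ e f → e ≡ f ⊎ e ≡ flipPM f
≡⊎≡flipPM plus  plus  = inj₁ refl
≡⊎≡flipPM plus  minus = inj₂ refl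
≡⊎≡flipPM minus plus  = inj₂ refl
≡⊎≡flipPM minus minus = inj₁ refl

flipSgn-involutive : ∀ x → flipSgn (flipSgn x) ≡ x
flipSgn-involutive neg = refl
flipSgn-involutive zer = refl
flipSgn-involutive pos = refl

flipSgn-pmS : ∀ e → flipSgn (pmS e) ≡ pmS (flipPM e)
flipSgn-pmS plus  = refl
flipSgn-pmS minus = refl

-- The index of {1,2,3} other than two distinct ones; third a a = a is a junk value.

third : Fin 3 → Fin 3 → Fin 3
third 0F 1F = 2F
third 0F 2F = 1F
third 1F 0F = 2F
third 1F 2F = 0F
third 2F 0F = 1F
third 2F 1F = 0F
third a  _  = a

next : Fin 3 → Fin 3
next 0F = 1F
next 1F = 2F
next 2F = 0F

next≢ : ∀ a → next a ≢ a
next≢ 0F ()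
next≢ 1F ()
next≢ 2F ()

third-≢ˡ : ∀ {a b} → a ≢ b → third a b ≢ a
third-≢ˡ {0F} {0F} a≢b = ⊥-elim (a≢b refl)
third-≢ˡ {0F} {1F} _ ()
third-≢ˡ {0F} {2F} _ ()
third-≢ˡ {1F} {0F} _ ()
third-≢ˡ {1F} {1F} a≢b = ⊥-elim (a≢b refl)
third-≢ˡ {1F} {2F} _ ()
third-≢ˡ {2F} {0F} _ ()
third-≢ˡ {2F} {1F} _ ()
third-≢ˡ {2F} {2F} a≢b = ⊥-elim (a≢b refl)

third-comm : ∀ a b → third a b ≡ third b a
third-comm 0F 0F = refl
third-comm 0F 1F = refl
third-comm 0F 2F = refl
third-comm 1F 0F = refl
third-comm 1F 1F = refl
third-comm 1F 2F = refl
third-comm 2F 0F = refl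
third-comm 2F 1F = refl
third-comm 2F 2F = refl

third-≢ʳ : ∀ {a b} → a ≢ b → third a b ≢ b
third-≢ʳ {a} {b} a≢b rewrite third-comm a b = third-≢ˡ (λ b≡a → a≢b (sym b≡a))

Fin3-cover : ∀ {a b} → a ≢ b → ∀ c → c ≡ a ⊎ c ≡ b ⊎ c ≡ third a b
Fin3-cover {0F} {0F} a≢b _  = ⊥-elim (a≢b refl)
Fin3-cover {1F} {1F} a≢b _  = ⊥-elim (a≢b refl)
Fin3-cover {2F} {2F} a≢b _  = ⊥-elim (a≢b refl)
Fin3-cover {0F} {1F} _ 0F = inj₁ refl
Fin3-cover {0F} {1F} _ 1F = inj₂ (inj₁ refl)
Fin3-cover {0F} {1F} _ 2F = inj₂ (inj₂ refl)
Fin3-cover {0F} {2F} _ 0F = inj₁ refl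
Fin3-cover {0F} {2F} _ 1F = inj₂ (inj₂ refl)
Fin3-cover {0F} {2F} _ 2F = inj₂ (inj₁ refl)
Fin3-cover {1F} {0F} _ 0F = inj₂ (inj₁ refl)
Fin3-cover {1F} {0F} _ 1F = inj₁ refl
Fin3-cover {1F} {0F} _ 2F = inj₂ (inj₂ refl)
Fin3-cover {1F} {2F} _ 0F = inj₂ (inj₂ refl)
Fin3-cover {1F} {2F} _ 1F = inj₁ refl
Fin3-cover {1F} {2F} _ 2F = inj₂ (inj₁ refl)
Fin3-cover {2F} {0F} _ 0F = inj₂ (inj₁ refl)
Fin3-cover {2F} {0F} _ 1F = inj₂ (inj₂ refl)
Fin3-cover {2F} {0F} _ 2F = inj₁ refl
Fin3-cover {2F} {1F} _ 0F = inj₂ (inj₂ refl)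
Fin3-cover {2F} {1F} _ 1F = inj₂ (inj₁ refl)
Fin3-cover {2F} {1F} _ 2F = inj₁ refl

third-unique : ∀ {a b c} → a ≢ b → c ≢ a → c ≢ b → c ≡ third a b
third-unique {c = c} a≢b c≢a c≢b with Fin3-cover a≢b c
... | inj₁ c≡a        = ⊥-elim (c≢a c≡a)
... | inj₂ (inj₁ c≡b) = ⊥-elim (c≢b c≡b)
... | inj₂ (inj₂ c≡t) = c≡t

distinct-cover : ∀ {a b c} → a ≢ b → c ≢ a → c ≢ b → ∀ i → i ≡ a ⊎ i ≡ b ⊎ i ≡ c
distinct-cover a≢b c≢a c≢b i with Fin3-cover a≢b i
... | inj₁ i≡a        = inj₁ i≡a
... | inj₂ (inj₁ i≡b) = inj₂ (inj₁ i≡b)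
... | inj₂ (inj₂ i≡t) = inj₂ (inj₂ (trans i≡t (sym (third-unique a≢b c≢a c≢b))))

cycPat-antisym : ∀ a b → cycPat a b ≡ flipSgn (cycPat b a)
cycPat-antisym 0F 0F = refl
cycPat-antisym 0F 1F = refl
cycPat-antisym 0F 2F = refl
cycPat-antisym 1F 0F = refl
cycPat-antisym 1F 1F = refl
cycPat-antisym 1F 2F = refl
cycPat-antisym 2F 0F = refl
cycPat-antisym 2F 1F = refl
cycPat-antisym 2F 2F = refl

cycPat-diag : ∀ a → cycPat a a ≡ zer
cycPat-diag 0F = refl
cycPat-diag 1F = refl
cycPat-diag 2F = refl

cycPat-offdiag : ∀ {a b} → a ≢ b → cycPat a b ≢ zer
cycPat-offdiag {0F} {0F} a≢b = ⊥-elim (a≢b refl)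
cycPat-offdiag {0F} {1F} _ ()
cycPat-offdiag {0F} {2F} _ ()
cycPat-offdiag {1F} {0F} _ ()
cycPat-offdiag {1F} {1F} a≢b = ⊥-elim (a≢b refl)
cycPat-offdiag {1F} {2F} _ ()
cycPat-offdiag {2F} {0F} _ ()
cycPat-offdiag {2F} {1F} _ ()
cycPat-offdiag {2F} {2F} a≢b = ⊥-elim (a≢b refl)

cycPat-rowThird : ∀ {a b} → a ≢ b → cycPat a (third a b) ≡ flipSgn (cycPat a b)
cycPat-rowThird {0F} {0F} a≢b = ⊥-elim (a≢b refl)
cycPat-rowThird {0F} {1F} _ = refl
cycPat-rowThird {0F} {2F} _ = refl
cycPat-rowThird {1F} {0F} _ = refl
cycPat-rowThird {1F} {1F} a≢b = ⊥-elim (a≢b refl)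
cycPat-rowThird {1F} {2F} _ = refl
cycPat-rowThird {2F} {0F} _ = refl
cycPat-rowThird {2F} {1F} _ = refl
cycPat-rowThird {2F} {2F} a≢b = ⊥-elim (a≢b refl)

cycPat-colThird : ∀ {a b} → a ≢ b → cycPat b (third a b) ≡ cycPat a b
cycPat-colThird {0F} {0F} a≢b = ⊥-elim (a≢b refl)
cycPat-colThird {0F} {1F} _ = refl
cycPat-colThird {0F} {2F} _ = refl
cycPat-colThird {1F} {0F} _ = refl
cycPat-colThird {1F} {1F} a≢b = ⊥-elim (a≢b refl)
cycPat-colThird {1F} {2F} _ = refl
cycPat-colThird {2F} {0F} _ = refl
cycPat-colThird {2F} {1F} _ = refl
cycPat-colThird {2F} {2F} a≢b = ⊥-elim (a≢b refl)

Reduced-init : ∀ v a → Reduced (v ∷ʳ a) → Reduced v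
Reduced-init []          _ _       = _
Reduced-init (_ ∷ [])    _ _       = _
Reduced-init (x ∷ y ∷ v) a (p , r) = p , Reduced-init (y ∷ v) a r

Reduced-last : ∀ v a b → Reduced ((v ∷ʳ a) ∷ʳ b) → a ≢ b
Reduced-last []          _ _ (p , _)     = p
Reduced-last (_ ∷ [])    _ _ (_ , p , _) = p
Reduced-last (_ ∷ y ∷ v) a b (_ , r)     = Reduced-last (y ∷ v) a b r

Reduced-snoc : ∀ v a b → Reduced (v ∷ʳ a) → a ≢ b → Reduced ((v ∷ʳ a) ∷ʳ b)
Reduced-snoc []          _ _ _       p = p , _
Reduced-snoc (_ ∷ [])    _ _ (q , _) p = q , p , _
Reduced-snoc (x ∷ y ∷ v) a b (q , r) p = q , Reduced-snoc (y ∷ v) a b r p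

extend-snoc : ∀ v k k' → k' ≢ k → extend (v ∷ʳ k) k' ≡ (v ∷ʳ k) ∷ʳ k'
extend-snoc []          k k' k'≢k with k ≟ k'
... | yes k≡k' = ⊥-elim (k'≢k (sym k≡k'))
... | no _     = refl
extend-snoc (x ∷ [])    k k' k'≢k = cong (x ∷_) (extend-snoc [] k k' k'≢k)
extend-snoc (x ∷ y ∷ v) k k' k'≢k = cong (x ∷_) (extend-snoc (y ∷ v) k k' k'≢k)

module OrderedField (ℝ : RealField) where
  open RealDefs ℝ

  private
    +-identityʳ′ : ∀ x → x + 0# ≡ x
    +-identityʳ′ x = trans (+-comm x 0#) (+-identityˡ x)

    *-identityʳ′ : ∀ x → x * 1# ≡ x
    *-identityʳ′ x = trans (*-comm x 1#) (*-identityˡ x)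

    distribʳ′ : ∀ x y z → (y + z) * x ≡ y * x + z * x
    distribʳ′ x y z =
      trans (*-comm (y + z) x) (trans (distribˡ x y z) (cong₂ _+_ (*-comm x y) (*-comm x z)))

  commutativeRing : CommutativeRing _ _
  commutativeRing = record
    { Carrier = R ; _≈_ = _≡_ ; _+_ = _+_ ; _*_ = _*_ ; -_ = -_ ; 0# = 0# ; 1# = 1#
    ; isCommutativeRing = record
      { isRing = record
        { +-isAbelianGroup = record
          { isGroup = record
            { isMonoid = record
              { isSemigroup = record
                { isMagma = record { isEquivalence = isEquivalence ; ∙-cong = cong₂ _+_ }
                ; assoc = +-assoc }
              ; identity = +-identityˡ , +-identityʳ′ }
            ; inverse = -‿inverseˡ , λ x → trans (+-comm x (- x)) (-‿inverseˡ x)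
            ; ⁻¹-cong = cong (λ x → - x) }
          ; comm = +-comm }
        ; *-cong = cong₂ _*_
        ; *-assoc = *-assoc
        ; *-identity = *-identityˡ , *-identityʳ′
        ; distrib = distribˡ , distribʳ′ }
      ; *-comm = *-comm } }

  open CommutativeRing commutativeRing public
    using (+-identityʳ; -‿inverseʳ; *-identityʳ; distribʳ; zeroˡ; zeroʳ; semiring)
  open import Algebra.Properties.Ring (CommutativeRing.ring commutativeRing) public
    using (-‿involutive; -0#≈0#; -‿distribˡ-*; -‿distribʳ-*; -‿+-comm; -1*x≈-x)
  open import Algebra.Properties.Semiring.Mult.TCOptimised semiring public
    using (×-homo-+; ×1-homo-*) renaming (_×_ to _·_; 1+× to 1+·)

  ⟦_⟧ℤ : ℤ → R
  ⟦ ℤ.+ n    ⟧ℤ = n · 1#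
  ⟦ -[1+ n ] ⟧ℤ = - (ℕ.suc n · 1#)

  private
    ⊖-homo : ∀ m n → ⟦ m ℤ.⊖ n ⟧ℤ ≡ m · 1# - n · 1#
    ⊖-homo m ℕ.zero = sym (trans (cong (m · 1# +_) -0#≈0#) (+-identityʳ _))
    ⊖-homo ℕ.zero (ℕ.suc n) = sym (+-identityˡ _)
    ⊖-homo (ℕ.suc m) (ℕ.suc n) = begin
      ⟦ ℕ.suc m ℤ.⊖ ℕ.suc n ⟧ℤ  ≡⟨ cong ⟦_⟧ℤ (ℤ.[1+m]⊖[1+n]≡m⊖n m n) ⟩
      ⟦ m ℤ.⊖ n ⟧ℤ              ≡⟨ ⊖-homo m n ⟩
      m · 1# - n · 1#           ≡⟨ shift (m · 1#) (n · 1#) ⟩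
      (1# + m · 1#) - (1# + n · 1#) ≡⟨ sym (cong₂ _-_ (1+· m 1#) (1+· n 1#)) ⟩
      ℕ.suc m · 1# - ℕ.suc n · 1# ∎
      where
      open ≡-Reasoning
      shift : ∀ a b → a - b ≡ (1# + a) - (1# + b)
      shift a b = begin
        a - b                       ≡⟨ sym (+-identityˡ _) ⟩
        0# + (a - b)                ≡⟨ cong (_+ (a - b)) (sym (-‿inverseʳ 1#)) ⟩
        (1# - 1#) + (a - b)         ≡⟨ +-assoc _ _ _ ⟩
        1# + (- 1# + (a - b))       ≡⟨ cong (1# +_) (trans (sym (+-assoc _ _ _))
                                         (trans (cong (_- b) (+-comm _ _)) (+-assoc _ _ _))) ⟩
        1# + (a + (- 1# - b))       ≡⟨ sym (+-assoc _ _ _) ⟩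
        (1# + a) + (- 1# - b)       ≡⟨ cong ((1# + a) +_) (-‿+-comm 1# b) ⟩
        (1# + a) - (1# + b)         ∎

    +-homo : ∀ i j → ⟦ i ℤ.+ j ⟧ℤ ≡ ⟦ i ⟧ℤ + ⟦ j ⟧ℤ
    +-homo -[1+ m ] -[1+ n ] = begin
      - (ℕ.suc (ℕ.suc (m ℕ.+ n)) · 1#)      ≡⟨ cong (λ l → - (ℕ.suc l · 1#)) (sym (+-suc m n)) ⟩
      - ((ℕ.suc m ℕ.+ ℕ.suc n) · 1#)        ≡⟨ cong (λ x → - x) (×-homo-+ 1# (ℕ.suc m) (ℕ.suc n)) ⟩
      - (ℕ.suc m · 1# + ℕ.suc n · 1#)       ≡⟨ sym (-‿+-comm _ _) ⟩
      - (ℕ.suc m · 1#) - (ℕ.suc n · 1#)     ∎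
      where open ≡-Reasoning
    +-homo -[1+ m ] (ℤ.+ n) = trans (⊖-homo n (ℕ.suc m)) (+-comm _ _)
    +-homo (ℤ.+ m) -[1+ n ] = ⊖-homo m (ℕ.suc n)
    +-homo (ℤ.+ m) (ℤ.+ n) = ×-homo-+ 1# m n

    -‿homo : ∀ i → ⟦ ℤ.- i ⟧ℤ ≡ - ⟦ i ⟧ℤ
    -‿homo -[1+ n ] = sym (-‿involutive _)
    -‿homo (ℤ.+ ℕ.zero) = sym -0#≈0#
    -‿homo (ℤ.+ ℕ.suc n) = refl

    ⟦_⟧s : Sign → R
    ⟦ Sign.+ ⟧s = 1#
    ⟦ Sign.- ⟧s = - 1#

    ◃-homo : ∀ s n → ⟦ s ℤ.◃ n ⟧ℤ ≡ ⟦ s ⟧s * n · 1#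
    ◃-homo Sign.- ℕ.zero    = sym (zeroʳ _)
    ◃-homo Sign.+ ℕ.zero    = sym (zeroʳ _)
    ◃-homo Sign.- (ℕ.suc n) = sym (-1*x≈-x _)
    ◃-homo Sign.+ (ℕ.suc n) = sym (*-identityˡ _)

    sign-abs : ∀ i → ⟦ i ⟧ℤ ≡ ⟦ ℤ.sign i ⟧s * ℤ.∣ i ∣ · 1#
    sign-abs -[1+ n ] = sym (-1*x≈-x _)
    sign-abs (ℤ.+ n)  = sym (*-identityˡ _)

    sign-*-homo : ∀ s t → ⟦ s Sign.* t ⟧s ≡ ⟦ s ⟧s * ⟦ t ⟧s
    sign-*-homo Sign.- Sign.- = sym (trans (-1*x≈-x _) (-‿involutive _))
    sign-*-homo Sign.- Sign.+ = sym (*-identityʳ _)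
    sign-*-homo Sign.+ Sign.- = sym (*-identityˡ _)
    sign-*-homo Sign.+ Sign.+ = sym (*-identityˡ _)

    *-interchange : ∀ a b c d → (a * b) * (c * d) ≡ (a * c) * (b * d)
    *-interchange a b c d = trans (*-assoc _ _ _) (trans (cong (a *_) (trans (sym (*-assoc _ _ _))
      (trans (cong (_* d) (*-comm b c)) (*-assoc _ _ _)))) (sym (*-assoc _ _ _)))

    *-homo : ∀ i j → ⟦ i ℤ.* j ⟧ℤ ≡ ⟦ i ⟧ℤ * ⟦ j ⟧ℤ
    *-homo i j = begin
      ⟦ i ℤ.* j ⟧ℤ
        ≡⟨ ◃-homo (ℤ.sign i Sign.* ℤ.sign j) (ℤ.∣ i ∣ ℕ.* ℤ.∣ j ∣) ⟩
      ⟦ ℤ.sign i Sign.* ℤ.sign j ⟧s * (ℤ.∣ i ∣ ℕ.* ℤ.∣ j ∣) · 1#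
        ≡⟨ cong₂ _*_ (sign-*-homo (ℤ.sign i) (ℤ.sign j)) (×1-homo-* ℤ.∣ i ∣ ℤ.∣ j ∣) ⟩
      (⟦ ℤ.sign i ⟧s * ⟦ ℤ.sign j ⟧s) * (ℤ.∣ i ∣ · 1# * ℤ.∣ j ∣ · 1#)
        ≡⟨ *-interchange _ _ _ _ ⟩
      (⟦ ℤ.sign i ⟧s * ℤ.∣ i ∣ · 1#) * (⟦ ℤ.sign j ⟧s * ℤ.∣ j ∣ · 1#)
        ≡⟨ sym (cong₂ _*_ (sign-abs i) (sign-abs j)) ⟩
      ⟦ i ⟧ℤ * ⟦ j ⟧ℤ ∎
      where open ≡-Reasoning

    ℤ-rawRing : RawRing _ _
    ℤ-rawRing = record
      { Carrier = ℤ ; _≈_ = _≡_ ; _+_ = ℤ._+_ ; _*_ = ℤ._*_ ; -_ = ℤ.-_ ; 0# = ℤ.+ 0 ; 1# = ℤ.+ 1 }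

    ℤ⟶ℝ : ℤ-rawRing -Raw-AlmostCommutative⟶ fromCommutativeRing commutativeRing
    ℤ⟶ℝ = record
      { ⟦_⟧ = ⟦_⟧ℤ ; +-homo = +-homo ; *-homo = *-homo ; -‿homo = -‿homo ; 0-homo = refl ; 1-homo = refl }

  open import Algebra.Solver.Ring ℤ-rawRing (fromCommutativeRing commutativeRing) ℤ⟶ℝ
    (λ i j → Maybe.map (cong ⟦_⟧ℤ) (dec⇒maybe (i ℤ.≟ j))) public
    using (solve; _:=_; _:+_; _:*_; :-_; _:-_; con)

  neg*neg : ∀ a b → (- a) * (- b) ≡ a * b
  neg*neg = solve 2 (λ a b → (:- a) :* (:- b) := a :* b) refl

  <-irrefl : ∀ {a} → ¬ (a < a)
  <-irrefl {a} a<a with compare a a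
  ... | tri< _ a≢a _ = a≢a refl
  ... | tri≈ ¬a<a _ _ = ¬a<a a<a
  ... | tri> _ a≢a _ = a≢a refl

  <-asym : ∀ {a b} → a < b → ¬ (b < a)
  <-asym a<b b<a = <-irrefl (<-trans a<b b<a)

  ≤-refl : ∀ {a} → a ≤ a
  ≤-refl = inj₂ refl

  ≤-trans : ∀ {a b c} → a ≤ b → b ≤ c → a ≤ c
  ≤-trans (inj₁ a<b) (inj₁ b<c)  = inj₁ (<-trans a<b b<c)
  ≤-trans (inj₁ a<b) (inj₂ refl) = inj₁ a<b
  ≤-trans (inj₂ refl) b≤c        = b≤c

  <-≤-trans : ∀ {a b c} → a < b → b ≤ c → a < c
  <-≤-trans a<b (inj₁ b<c)  = <-trans a<b b<c
  <-≤-trans a<b (inj₂ refl) = a<b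

  ≮⇒≥ : ∀ {a b} → ¬ (a < b) → b ≤ a
  ≮⇒≥ {a} {b} a≮b with compare a b
  ... | tri< a<b _ _ = ⊥-elim (a≮b a<b)
  ... | tri≈ _ a≡b _ = inj₂ (sym a≡b)
  ... | tri> _ _ b<a = inj₁ b<a

  ≤⇒≯ : ∀ {a b} → a ≤ b → ¬ (b < a)
  ≤⇒≯ (inj₁ a<b)  b<a = <-asym a<b b<a
  ≤⇒≯ (inj₂ refl) a<a = <-irrefl a<a

  ≤-total : ∀ a b → a ≤ b ⊎ b < a
  ≤-total a b with compare a b
  ... | tri< a<b _ _ = inj₁ (inj₁ a<b)
  ... | tri≈ _ a≡b _ = inj₁ (inj₂ a≡b)
  ... | tri> _ _ b<a = inj₂ b<a

  +-monoʳ-< : ∀ {a b} c → a < b → c + a < c + b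
  +-monoʳ-< {a} {b} c a<b = subst₂ _<_ (+-comm a c) (+-comm b c) (+-mono-< c a<b)

  +-monoˡ-≤ : ∀ {a b} c → a ≤ b → a + c ≤ b + c
  +-monoˡ-≤ c (inj₁ a<b)  = inj₁ (+-mono-< c a<b)
  +-monoˡ-≤ c (inj₂ refl) = inj₂ refl

  neg-antimono-< : ∀ {a b} → a < b → - b < - a
  neg-antimono-< {a} {b} a<b = subst₂ _<_
    (solve 2 (λ a b → a :+ (:- a :+ :- b) := :- b) refl a b)
    (solve 2 (λ a b → b :+ (:- a :+ :- b) := :- a) refl a b)
    (+-mono-< (- a + - b) a<b)

  neg-antimono-≤ : ∀ {a b} → a ≤ b → - b ≤ - a
  neg-antimono-≤ (inj₁ a<b)  = inj₁ (neg-antimono-< a<b)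
  neg-antimono-≤ (inj₂ refl) = inj₂ refl

  <0⇒0<neg : ∀ {a} → a < 0# → 0# < - a
  <0⇒0<neg a<0 = subst (_< _) -0#≈0# (neg-antimono-< a<0)

  0<⇒neg<0 : ∀ {a} → 0# < a → - a < 0#
  0<⇒neg<0 0<a = subst (_ <_) -0#≈0# (neg-antimono-< 0<a)

  0<neg⇒<0 : ∀ {a} → 0# < - a → a < 0#
  0<neg⇒<0 {a} 0<-a = subst (_< 0#) (-‿involutive a) (0<⇒neg<0 0<-a)

  0<1 : 0# < 1#
  0<1 with compare 0# 1#
  ... | tri< 0<1 _ _ = 0<1
  ... | tri≈ _ 0≡1 _ = ⊥-elim (0≢1 0≡1)
  ... | tri> _ _ 1<0 = ⊥-elim (<-asym 1<0 (subst (0# <_) (trans (neg*neg 1# 1#) (*-identityˡ 1#))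
                         (*-pos (<0⇒0<neg 1<0) (<0⇒0<neg 1<0))))

  pos+nonneg : ∀ {a b} → 0# < a → 0# ≤ b → 0# < a + b
  pos+nonneg {a} {b} 0<a (inj₁ 0<b) = <-trans 0<b (subst (_< a + b) (+-identityˡ b) (+-mono-< b 0<a))
  pos+nonneg {a} 0<a (inj₂ refl) = subst (0# <_) (sym (+-identityʳ a)) 0<a

  nonneg+nonneg : ∀ {a b} → 0# ≤ a → 0# ≤ b → 0# ≤ a + b
  nonneg+nonneg (inj₁ 0<a) 0≤b = inj₁ (pos+nonneg 0<a 0≤b)
  nonneg+nonneg {b = b} (inj₂ refl) 0≤b = subst (0# ≤_) (sym (+-identityˡ b)) 0≤b

  nonneg*nonneg : ∀ {a b} → 0# ≤ a → 0# ≤ b → 0# ≤ a * b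
  nonneg*nonneg (inj₁ 0<a) (inj₁ 0<b) = inj₁ (*-pos 0<a 0<b)
  nonneg*nonneg {a} (inj₁ _) (inj₂ refl) = inj₂ (sym (zeroʳ a))
  nonneg*nonneg {b = b} (inj₂ refl) _ = inj₂ (sym (zeroˡ b))

  pos*neg<0 : ∀ {a b} → 0# < a → b < 0# → a * b < 0#
  pos*neg<0 {a} {b} 0<a b<0 =
    0<neg⇒<0 (subst (0# <_) (sym (-‿distribʳ-* a b)) (*-pos 0<a (<0⇒0<neg b<0)))

  neg*pos<0 : ∀ {a b} → a < 0# → 0# < b → a * b < 0#
  neg*pos<0 {a} {b} a<0 0<b = subst (_< 0#) (*-comm b a) (pos*neg<0 0<b a<0)

  *-cancelˡ-nonneg : ∀ {a b} → 0# < a → 0# ≤ a * b → 0# ≤ b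
  *-cancelˡ-nonneg {a} {b} 0<a 0≤ab with ≤-total 0# b
  ... | inj₁ 0≤b = 0≤b
  ... | inj₂ b<0 = ⊥-elim (≤⇒≯ 0≤ab (pos*neg<0 0<a b<0))

  *-cancelˡ-pos : ∀ {a b} → 0# < a → 0# < a * b → 0# < b
  *-cancelˡ-pos {a} {b} 0<a 0<ab with ≤-total b 0#
  ... | inj₂ 0<b = 0<b
  ... | inj₁ (inj₁ b<0) = ⊥-elim (<-asym 0<ab (pos*neg<0 0<a b<0))
  ... | inj₁ (inj₂ refl) = ⊥-elim (<-irrefl (subst (0# <_) (zeroʳ a) 0<ab))

  private
    sub+cancel : ∀ a b → (b - a) + a ≡ b
    sub+cancel = solve 2 (λ a b → (b :- a) :+ a := b) refl

  0≤diff⇒≤ : ∀ {a b} → 0# ≤ b - a → a ≤ b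
  0≤diff⇒≤ {a} {b} 0≤b-a = subst₂ _≤_ (+-identityˡ a) (sub+cancel a b) (+-monoˡ-≤ a 0≤b-a)

  ≤⇒0≤diff : ∀ {a b} → a ≤ b → 0# ≤ b - a
  ≤⇒0≤diff {a} a≤b = subst (_≤ _) (-‿inverseʳ a) (+-monoˡ-≤ (- a) a≤b)

  0<diff⇒≢ : ∀ {a b} → 0# < b - a → a ≢ b
  0<diff⇒≢ {a} 0<a-a refl = <-irrefl (subst (0# <_) (-‿inverseʳ a) 0<a-a)

  x≤x+δ : ∀ {x δ} → 0# ≤ δ → x ≤ x + δ
  x≤x+δ {x} {δ} 0≤δ = 0≤diff⇒≤ (subst (0# ≤_) (solve 2 (λ x d → d := x :+ d :- x) refl x δ) 0≤δ)

  x≢x+δ : ∀ {x δ} → 0# < δ → x ≢ x + δ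
  x≢x+δ {x} {δ} 0<δ = 0<diff⇒≢ (subst (0# <_) (solve 2 (λ x d → d := x :+ d :- x) refl x δ) 0<δ)

  sgn≡pos⇒pos : ∀ {a} → sgn a ≡ pos → 0# < a
  sgn≡pos⇒pos {a} _ with compare a 0#
  sgn≡pos⇒pos () | tri< _ _ _
  sgn≡pos⇒pos () | tri≈ _ _ _
  ... | tri> _ _ 0<a = 0<a

  sgn≡neg⇒neg : ∀ {a} → sgn a ≡ neg → a < 0#
  sgn≡neg⇒neg {a} _ with compare a 0#
  ... | tri< a<0 _ _ = a<0
  sgn≡neg⇒neg () | tri≈ _ _ _
  sgn≡neg⇒neg () | tri> _ _ _

  sgn≡zer⇒zero : ∀ {a} → sgn a ≡ zer → a ≡ 0#
  sgn≡zer⇒zero {a} _ with compare a 0#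
  sgn≡zer⇒zero () | tri< _ _ _
  ... | tri≈ _ a≡0 _ = a≡0
  sgn≡zer⇒zero () | tri> _ _ _

  pos⇒sgn≡pos : ∀ {a} → 0# < a → sgn a ≡ pos
  pos⇒sgn≡pos {a} 0<a with compare a 0#
  ... | tri< a<0 _ _  = ⊥-elim (<-asym 0<a a<0)
  ... | tri≈ _ refl _ = ⊥-elim (<-irrefl 0<a)
  ... | tri> _ _ _    = refl

  neg⇒sgn≡neg : ∀ {a} → a < 0# → sgn a ≡ neg
  neg⇒sgn≡neg {a} a<0 with compare a 0#
  ... | tri< _ _ _    = refl
  ... | tri≈ _ refl _ = ⊥-elim (<-irrefl a<0)
  ... | tri> _ _ 0<a  = ⊥-elim (<-asym a<0 0<a)

  sgn-zero : sgn 0# ≡ zer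
  sgn-zero with compare 0# 0#
  ... | tri< 0<0 _ _ = ⊥-elim (<-irrefl 0<0)
  ... | tri≈ _ _ _   = refl
  ... | tri> _ _ 0<0 = ⊥-elim (<-irrefl 0<0)

  sgn-neg : ∀ a → sgn (- a) ≡ flipSgn (sgn a)
  sgn-neg a with compare a 0#
  ... | tri< a<0 _ _  = pos⇒sgn≡pos (<0⇒0<neg a<0)
  ... | tri≈ _ refl _ = trans (cong sgn -0#≈0#) sgn-zero
  ... | tri> _ _ 0<a  = neg⇒sgn≡neg (0<⇒neg<0 0<a)

  pos⇒sgnR≡1 : ∀ {a} → 0# < a → sgnR a ≡ 1#
  pos⇒sgnR≡1 {a} 0<a with compare a 0#
  ... | tri< a<0 _ _  = ⊥-elim (<-asym 0<a a<0)
  ... | tri≈ _ refl _ = ⊥-elim (<-irrefl 0<a)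
  ... | tri> _ _ _    = refl

  neg⇒sgnR≡-1 : ∀ {a} → a < 0# → sgnR a ≡ - 1#
  neg⇒sgnR≡-1 {a} a<0 with compare a 0#
  ... | tri< _ _ _    = refl
  ... | tri≈ _ refl _ = ⊥-elim (<-irrefl a<0)
  ... | tri> _ _ 0<a  = ⊥-elim (<-asym a<0 0<a)

  ∣i∣≡i : ∀ {a} → 0# < a → ∣ a ∣ ≡ a
  ∣i∣≡i {a} 0<a with compare a 0#
  ... | tri< a<0 _ _ = ⊥-elim (<-asym 0<a a<0)
  ... | tri≈ _ _ _   = refl
  ... | tri> _ _ _   = refl

  ∣i∣≡-i : ∀ {a} → a < 0# → ∣ a ∣ ≡ - a
  ∣i∣≡-i {a} a<0 with compare a 0#
  ... | tri< _ _ _    = refl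
  ... | tri≈ _ refl _ = ⊥-elim (<-irrefl a<0)
  ... | tri> _ _ 0<a  = ⊥-elim (<-asym a<0 0<a)

  ∣0∣≡0 : ∣ 0# ∣ ≡ 0#
  ∣0∣≡0 with compare 0# 0#
  ... | tri< _ _ _ = -0#≈0#
  ... | tri≈ _ _ _ = refl
  ... | tri> _ _ _ = refl

  0≤∣i∣ : ∀ a → 0# ≤ ∣ a ∣
  0≤∣i∣ a with compare a 0#
  ... | tri< a<0 _ _ = inj₁ (<0⇒0<neg a<0)
  ... | tri≈ _ a≡0 _ = inj₂ (sym a≡0)
  ... | tri> _ _ 0<a = inj₁ 0<a

  ∣-i∣≡∣i∣ : ∀ a → ∣ - a ∣ ≡ ∣ a ∣
  ∣-i∣≡∣i∣ a with compare a 0#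
  ... | tri< a<0 _ _  = ∣i∣≡i (<0⇒0<neg a<0)
  ... | tri≈ _ refl _ = trans (cong ∣_∣ -0#≈0#) ∣0∣≡0
  ... | tri> _ _ 0<a  = trans (∣i∣≡-i (0<⇒neg<0 0<a)) (-‿involutive a)

  ∣i*j∣≡∣i∣*∣j∣ : ∀ a b → ∣ a * b ∣ ≡ ∣ a ∣ * ∣ b ∣
  ∣i*j∣≡∣i∣*∣j∣ a b with compare a 0# | compare b 0#
  ... | tri< a<0 _ _  | tri< b<0 _ _  = trans (∣i∣≡i (subst (0# <_) (neg*neg a b)
                                          (*-pos (<0⇒0<neg a<0) (<0⇒0<neg b<0)))) (sym (neg*neg a b))
  ... | tri< _ _ _    | tri≈ _ refl _ = trans (cong ∣_∣ (zeroʳ a)) (trans ∣0∣≡0 (sym (zeroʳ _)))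
  ... | tri< a<0 _ _  | tri> _ _ 0<b  = trans (∣i∣≡-i (neg*pos<0 a<0 0<b)) (-‿distribˡ-* a b)
  ... | tri≈ _ refl _ | _             = trans (cong ∣_∣ (zeroˡ b)) (trans ∣0∣≡0 (sym (zeroˡ _)))
  ... | tri> _ _ 0<a  | tri< b<0 _ _  = trans (∣i∣≡-i (pos*neg<0 0<a b<0)) (-‿distribʳ-* a b)
  ... | tri> _ _ _    | tri≈ _ refl _ = trans (cong ∣_∣ (zeroʳ a)) (trans ∣0∣≡0 (sym (zeroʳ _)))
  ... | tri> _ _ 0<a  | tri> _ _ 0<b  = ∣i∣≡i (*-pos 0<a 0<b)

  max0-pos : ∀ {a} → 0# < a → max0 a ≡ a
  max0-pos {a} 0<a with compare a 0#
  ... | tri< a<0 _ _  = ⊥-elim (<-asym 0<a a<0)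
  ... | tri≈ _ refl _ = ⊥-elim (<-irrefl 0<a)
  ... | tri> _ _ _    = refl

  max0-nonpos : ∀ {a} → a ≤ 0# → max0 a ≡ 0#
  max0-nonpos {a} a≤0 with compare a 0#
  ... | tri< _ _ _   = refl
  ... | tri≈ _ _ _   = refl
  ... | tri> _ _ 0<a = ⊥-elim (≤⇒≯ a≤0 0<a)

  max0-zero : max0 0# ≡ 0#
  max0-zero = max0-nonpos ≤-refl

  max0-nonneg : ∀ {a} → 0# ≤ a → max0 a ≡ a
  max0-nonneg (inj₁ 0<a)  = max0-pos 0<a
  max0-nonneg (inj₂ refl) = max0-zero

  max0-sub : ∀ b → max0 b - b ≡ max0 (- b)
  max0-sub b with compare b 0#
  ... | tri< b<0 _ _  = trans (+-identityˡ _) (sym (max0-pos (<0⇒0<neg b<0)))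
  ... | tri≈ _ refl _ = trans (+-identityˡ _) (trans -0#≈0# (sym (trans (cong max0 -0#≈0#) max0-zero)))
  ... | tri> _ _ 0<b  = trans (-‿inverseʳ b) (sym (max0-nonpos (inj₁ (0<⇒neg<0 0<b))))

  pmR-flipPM : ∀ e → pmR (flipPM e) ≡ - pmR e
  pmR-flipPM plus  = refl
  pmR-flipPM minus = sym (-‿involutive 1#)

  pmR*-pos : ∀ e {b} → sgn b ≡ pmS e → 0# < pmR e * b
  pmR*-pos plus  {b} sgn≡ = subst (0# <_) (sym (*-identityˡ b)) (sgn≡pos⇒pos sgn≡)
  pmR*-pos minus {b} sgn≡ = subst (0# <_) (sym (-1*x≈-x b)) (<0⇒0<neg (sgn≡neg⇒neg sgn≡))

  pmR*-neg : ∀ e {b} → sgn b ≡ flipSgn (pmS e) → pmR e * b < 0#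
  pmR*-neg e {b} sgn≡ = 0<neg⇒<0 (subst (0# <_)
    (trans (cong (_* b) (pmR-flipPM e)) (sym (-‿distribˡ-* (pmR e) b)))
    (pmR*-pos (flipPM e) (trans sgn≡ (flipSgn-pmS e))))

  ∣i∣≡pmR* : ∀ e {b} → sgn b ≡ pmS e → ∣ b ∣ ≡ pmR e * b
  ∣i∣≡pmR* plus  {b} sgn≡ = trans (∣i∣≡i (sgn≡pos⇒pos sgn≡)) (sym (*-identityˡ b))
  ∣i∣≡pmR* minus {b} sgn≡ = trans (∣i∣≡-i (sgn≡neg⇒neg sgn≡)) (sym (-1*x≈-x b))

  sgnR≡pmR : ∀ e {b} → sgn b ≡ pmS e → sgnR b ≡ pmR e
  sgnR≡pmR plus  sgn≡ = pos⇒sgnR≡1 (sgn≡pos⇒pos sgn≡)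
  sgnR≡pmR minus sgn≡ = neg⇒sgnR≡-1 (sgn≡neg⇒neg sgn≡)

  1≢-1 : 1# ≢ - 1#
  1≢-1 1≡-1 = <-asym 0<1 (subst (_< 0#) (sym 1≡-1) (0<⇒neg<0 0<1))

  pmR*pmR≡-1 : ∀ e f → pmR e * pmR f ≡ - 1# → e ≡ flipPM f
  pmR*pmR≡-1 plus  minus _ = refl
  pmR*pmR≡-1 minus plus  _ = refl
  pmR*pmR≡-1 plus  plus  eq = ⊥-elim (1≢-1 (trans (sym (*-identityˡ 1#)) eq))
  pmR*pmR≡-1 minus minus eq = ⊥-elim (1≢-1 (trans (sym (trans (neg*neg 1# 1#) (*-identityˡ 1#))) eq))

  pmR*-uniqueness : ∀ {e f} (c : Fin 3 → R) → (∀ j → 0# ≤ pmR e * c j) → (∃ λ j → 0# < pmR f * c j) →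
                    e ≡ f
  pmR*-uniqueness {e} {f} c nonneg (j , 0<fc) with ≡⊎≡flipPM e f
  ... | inj₁ e≡f = e≡f
  ... | inj₂ refl = ⊥-elim (≤⇒≯ (nonneg j) (subst (_< 0#)
        (trans (-‿distribˡ-* _ _) (cong (_* c j) (sym (pmR-flipPM f)))) (0<⇒neg<0 0<fc)))

  x≤y+x : ∀ {x y} → 0# ≤ y → x ≤ y + x
  x≤y+x {x} {y} 0≤y = subst₂ _≤_ (+-identityˡ x) refl (+-monoˡ-≤ x 0≤y)

  archimedean : ∀ {c} A → 0# < c → ¬ (∀ n → n · 1# * c ≤ A)
  archimedean {c} A 0<c bounded = least (S - c) S-c-bound S-c<S
    where
    Multiple : R → Set
    Multiple x = ∃ λ n → x ≡ n · 1# * c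

    supremum = sup Multiple (0 · 1# * c , 0 , refl) (A , λ { _ (n , refl) → ≤⇒≯ (bounded n) })
    S = proj₁ supremum
    S-bound = proj₁ (proj₂ supremum)
    least = proj₂ (proj₂ supremum)

    S-c+c : S - c + c ≡ S
    S-c+c = solve 2 (λ s c → s :- c :+ c := s) refl S c

    S-c<S : S - c < S
    S-c<S = subst₂ _<_ (+-identityʳ (S - c)) S-c+c (+-monoʳ-< (S - c) 0<c)

    S-c-bound : ∀ x → Multiple x → ¬ (S - c < x)
    S-c-bound _ (n , refl) S-c<nc = S-bound (ℕ.suc n · 1# * c) (ℕ.suc n , refl)
      (subst₂ _<_ S-c+c (trans (+-comm _ c) (trans (cong (_+ n · 1# * c) (sym (*-identityˡ c)))
        (trans (sym (distribʳ c 1# (n · 1#))) (cong (_* c) (sym (1+· n 1#))))))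
        (+-mono-< c S-c<nc))

  no-nonneg-linear-descent : ∀ {c} (f : ℕ → R) → 0# < c → (∀ m → f (ℕ.suc m) + c ≤ f m) →
                             ¬ (∀ m → 0# ≤ f m)
  no-nonneg-linear-descent {c} f 0<c descent f-nonneg =
    archimedean (f 0) 0<c λ m → ≤-trans (x≤y+x (f-nonneg m)) (partial-sum m)
    where
    partial-sum : ∀ m → f m + m · 1# * c ≤ f 0
    partial-sum ℕ.zero = inj₂ (trans (cong (f 0 +_) (zeroˡ c)) (+-identityʳ (f 0)))
    partial-sum (ℕ.suc m) = ≤-trans (subst (_≤ f m + m · 1# * c) regroup
      (+-monoˡ-≤ (m · 1# * c) (descent m))) (partial-sum m)
      where
      regroup : f (ℕ.suc m) + c + m · 1# * c ≡ f (ℕ.suc m) + ℕ.suc m · 1# * c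
      regroup = trans (solve 3 (λ x c y → x :+ c :+ y :* c := x :+ (c :+ y :* c)) refl (f (ℕ.suc m)) c (m · 1#))
        (cong (λ y → f (ℕ.suc m) + y) (sym (trans (cong (_* c) (1+· m 1#))
          (trans (distribʳ c 1# (m · 1#)) (cong (_+ m · 1# * c) (*-identityˡ c))))))

  -- If a_{n+1} - a_n ever became negative it would stay below that value, driving a to -∞;
  -- so a is nondecreasing, and then for l < 2 the differences themselves descend linearly.
  positive-recurrence⇒2≤ : ∀ l (a : ℕ → R) → (∀ n → 0# < a n) →
                           (∀ n → a (ℕ.suc (ℕ.suc n)) ≡ l * a (ℕ.suc n) - a n) → 2# ≤ l
  positive-recurrence⇒2≤ l a a-pos a-rec with ≤-total 2# l
  ... | inj₁ 2≤l = 2≤l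
  ... | inj₂ l<2 = ⊥-elim (no-nonneg-linear-descent Δ c>0 Δ-descent Δ-nonneg)
    where
    q = l - 2#
    q<0 : q < 0#
    q<0 = subst (q <_) (-‿inverseʳ 2#) (+-mono-< (- 2#) l<2)

    Δ : ℕ → R
    Δ n = a (ℕ.suc n) - a n

    Δ-step : ∀ n → Δ (ℕ.suc n) ≡ Δ n + q * a (ℕ.suc n)
    Δ-step n = trans (cong (_- a (ℕ.suc n)) (a-rec n))
      (solve 3 (λ l a₀ a₁ → (l :* a₁ :- a₀) :- a₁ := (a₁ :- a₀) :+ (l :- con (ℤ.+ 2)) :* a₁) refl
        l (a n) (a (ℕ.suc n)))

    Δ-antitone : ∀ N m → Δ (m ℕ.+ N) ≤ Δ N
    Δ-antitone N ℕ.zero = ≤-refl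
    Δ-antitone N (ℕ.suc m) = ≤-trans (inj₁ (subst₂ _<_ (sym (Δ-step (m ℕ.+ N))) (+-identityʳ _)
      (+-monoʳ-< (Δ (m ℕ.+ N)) (neg*pos<0 q<0 (a-pos _))))) (Δ-antitone N m)

    Δ-nonneg : ∀ N → 0# ≤ Δ N
    Δ-nonneg N = ≮⇒≥ λ ΔN<0 → no-nonneg-linear-descent (λ m → a (m ℕ.+ N)) (<0⇒0<neg ΔN<0)
      (λ m → subst₂ _≤_ (solve 3 (λ a₀ a₁ d → (a₁ :- a₀) :+ (a₀ :- d) := a₁ :+ (:- d)) refl
                           (a (m ℕ.+ N)) (a (ℕ.suc m ℕ.+ N)) (Δ N))
                        (solve 2 (λ a₀ d → d :+ (a₀ :- d) := a₀) refl (a (m ℕ.+ N)) (Δ N))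
                        (+-monoˡ-≤ (a (m ℕ.+ N) - Δ N) (Δ-antitone N m)))
      (λ m → inj₁ (a-pos (m ℕ.+ N)))

    a₀≤a : ∀ n → a 0 ≤ a n
    a₀≤a ℕ.zero = ≤-refl
    a₀≤a (ℕ.suc n) = ≤-trans (a₀≤a n) (0≤diff⇒≤ (Δ-nonneg n))

    c = - (q * a 0)
    c>0 : 0# < c
    c>0 = <0⇒0<neg (neg*pos<0 q<0 (a-pos 0))

    Δ-descent : ∀ n → Δ (ℕ.suc n) + c ≤ Δ n
    Δ-descent n = 0≤diff⇒≤ (subst (0# ≤_)
      (trans (solve 4 (λ d q a₀ a₁ → (:- q) :* (a₁ :- a₀) := d :- (d :+ q :* a₁ :+ (:- (q :* a₀)))) refl
               (Δ n) q (a 0) (a (ℕ.suc n)))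
             (cong (λ x → Δ n - (x + c)) (sym (Δ-step n))))
      (nonneg*nonneg (inj₁ (<0⇒0<neg q<0)) (≤⇒0≤diff (a₀≤a (ℕ.suc n)))))

module MutationFormulas (ℝ : RealField) where
  open RealDefs ℝ
  open OrderedField ℝ

  Cμ : Mat → Mat → Fin 3 → Mat
  Cμ B C k = proj₂ (step (B , C) k)

  private
    sum3-single : ∀ (f : Fin 3 → R) a → (∀ m → m ≢ a → f m ≡ 0#) → sum3 f ≡ f a
    sum3-single f 0F f≡0 rewrite f≡0 1F (λ ()) | f≡0 2F (λ ()) =
      trans (+-identityʳ _) (+-identityʳ _)
    sum3-single f 1F f≡0 rewrite f≡0 0F (λ ()) | f≡0 2F (λ ()) =
      trans (+-identityʳ _) (+-identityˡ _)
    sum3-single f 2F f≡0 rewrite f≡0 0F (λ ()) | f≡0 1F (λ ()) =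
      trans (cong (_+ f 2F) (+-identityʳ _)) (+-identityˡ _)

    sum3-+ : ∀ (f g : Fin 3 → R) → sum3 (λ m → f m + g m) ≡ sum3 f + sum3 g
    sum3-+ f g = solve 6 (λ a b c d e h → (a :+ d) :+ (b :+ e) :+ (c :+ h) := (a :+ b :+ c) :+ (d :+ e :+ h))
      refl (f 0F) (f 1F) (f 2F) (g 0F) (g 1F) (g 2F)

    sum3-cong : ∀ {f g : Fin 3 → R} → (∀ m → f m ≡ g m) → sum3 f ≡ sum3 g
    sum3-cong f≡g = cong₂ _+_ (cong₂ _+_ (f≡g 0F) (f≡g 1F)) (f≡g 2F)

    J-offdiag : ∀ k {m i} → m ≢ i → J k m i ≡ 0#
    J-offdiag k {m} {i} m≢i with m ≟ i
    ... | yes m≡i = ⊥-elim (m≢i m≡i)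
    ... | no _    = refl

    rowOnly-off : ∀ k (A : Mat) {m i} → m ≢ k → rowOnly k A m i ≡ 0#
    rowOnly-off k A {m} m≢k with m ≟ k
    ... | yes m≡k = ⊥-elim (m≢k m≡k)
    ... | no _    = refl

    rowOnly-on : ∀ k (A : Mat) i → rowOnly k A k i ≡ A k i
    rowOnly-on k A i with k ≟ k
    ... | yes _   = refl
    ... | no k≢k = ⊥-elim (k≢k refl)

    colOnly-off : ∀ k (A : Mat) {j m} → m ≢ k → colOnly k A j m ≡ 0#
    colOnly-off k A {m = m} m≢k with m ≟ k
    ... | yes m≡k = ⊥-elim (m≢k m≡k)
    ... | no _    = refl

    colOnly-on : ∀ k (A : Mat) j → colOnly k A j k ≡ A j k
    colOnly-on k A j with k ≟ k
    ... | yes _   = refl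
    ... | no k≢k = ⊥-elim (k≢k refl)

    ⊗J : ∀ (C : Mat) k j i → (C ⊗ J k) j i ≡ C j i * J k i i
    ⊗J C k j i = sum3-single (λ l → C j l * J k l i) i
      (λ m m≢i → trans (cong (C j m *_) (J-offdiag k m≢i)) (zeroʳ _))

    ⊗rowOnly : ∀ (C P : Mat) k j i → (C ⊗ rowOnly k P) j i ≡ C j k * P k i
    ⊗rowOnly C P k j i = trans (sum3-single (λ l → C j l * rowOnly k P l i) k
      (λ m m≢k → trans (cong (C j m *_) (rowOnly-off k P m≢k)) (zeroʳ _)))
      (cong (C j k *_) (rowOnly-on k P i))

    colOnly⊗ : ∀ (Q B : Mat) k j i → (colOnly k Q ⊗ B) j i ≡ Q j k * B k i
    colOnly⊗ Q B k j i = trans (sum3-single (λ l → colOnly k Q j l * B l i) k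
      (λ m m≢k → trans (cong (_* B m i) (colOnly-off k Q m≢k)) (zeroˡ _)))
      (cong (_* B k i) (colOnly-on k Q j))

    [J⊕colOnly]⊗ : ∀ (P M : Mat) k i l → ((J k ⊕ colOnly k P) ⊗ M) i l ≡ J k i i * M i l + P i k * M k l
    [J⊕colOnly]⊗ P M k i l =
      trans (sum3-cong (λ m → distribʳ (M m l) (J k i m) (colOnly k P i m)))
      (trans (sum3-+ (λ m → J k i m * M m l) (λ m → colOnly k P i m * M m l))
      (cong₂ _+_ (sum3-single (λ m → J k i m * M m l) i
                   (λ m m≢i → trans (cong (_* M m l) (J-offdiag k (λ i≡m → m≢i (sym i≡m)))) (zeroˡ _)))
                 (colOnly⊗ P M k i l)))

    ⊗[J⊕rowOnly] : ∀ (N Q : Mat) k i j → (N ⊗ (J k ⊕ rowOnly k Q)) i j ≡ N i j * J k j j + N i k * Q k j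
    ⊗[J⊕rowOnly] N Q k i j =
      trans (sum3-cong (λ m → distribˡ (N i m) (J k m j) (rowOnly k Q m j)))
      (trans (sum3-+ (λ m → N i m * J k m j) (λ m → N i m * rowOnly k Q m j))
      (cong₂ _+_ (⊗J N k i j) (⊗rowOnly N Q k i j)))

  J-kk : ∀ k → J k k k ≡ - 1#
  J-kk k with k ≟ k
  ... | yes _   = refl
  ... | no k≢k = ⊥-elim (k≢k refl)

  J-ii : ∀ k {i} → i ≢ k → J k i i ≡ 1#
  J-ii k {i} i≢k with i ≟ i | i ≟ k
  ... | yes _ | yes i≡k = ⊥-elim (i≢k i≡k)
  ... | yes _ | no _    = refl
  ... | no i≢i | _      = ⊥-elim (i≢i refl)

  μ-entry : ∀ k (M : Mat) i j → μ k M i j ≡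
    (J k i i * M i j + max0 (- M i k) * M k j) * J k j j
      + (J k i i * M i k + max0 (- M i k) * M k k) * max0 (M k j)
  μ-entry k M i j = trans (⊗[J⊕rowOnly] ((J k ⊕ colOnly k (posM (negM M))) ⊗ M) (posM M) k i j)
    (cong₂ _+_ (cong (_* J k j j) ([J⊕colOnly]⊗ (posM (negM M)) M k i j))
               (cong (_* max0 (M k j)) ([J⊕colOnly]⊗ (posM (negM M)) M k i k)))

  Cμ-entry : ∀ (B C : Mat) k j i →
             Cμ B C k j i ≡ C j i * J k i i + C j k * max0 (B k i) + max0 (- C j k) * B k i
  Cμ-entry B C k j i = cong₂ _+_ (cong₂ _+_ (⊗J C k j i) (⊗rowOnly C (posM B) k j i))
                                 (colOnly⊗ (posM (negM C)) B k j i)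

  μ-row : ∀ k (M : Mat) {j} → M k k ≡ 0# → j ≢ k → μ k M k j ≡ - M k j
  μ-row k M {j} Mkk≡0 j≢k = trans (μ-entry k M k j) (trans
    (cong₂ (λ p m → (J k k k * M k j + p * M k j) * J k j j + (J k k k * m + p * m) * max0 (M k j))
      (trans (cong (λ m → max0 (- m)) Mkk≡0) (trans (cong max0 -0#≈0#) max0-zero)) Mkk≡0)
    (trans (cong₂ (λ a b → (a * M k j + 0# * M k j) * b + (a * 0# + 0# * 0#) * max0 (M k j)) (J-kk k) (J-ii k j≢k))
    (solve 2 (λ a q → (:- con (ℤ.+ 1) :* a :+ con (ℤ.+ 0) :* a) :* con (ℤ.+ 1)
                     :+ (:- con (ℤ.+ 1) :* con (ℤ.+ 0) :+ con (ℤ.+ 0) :* con (ℤ.+ 0)) :* q := :- a)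
      refl (M k j) (max0 (M k j)))))

  μ-col : ∀ k (M : Mat) {i} → M k k ≡ 0# → i ≢ k → μ k M i k ≡ - M i k
  μ-col k M {i} Mkk≡0 i≢k = trans (μ-entry k M i k) (trans
    (cong₂ (λ m q → (J k i i * M i k + max0 (- M i k) * m) * J k k k + (J k i i * M i k + max0 (- M i k) * m) * q)
      Mkk≡0 (trans (cong max0 Mkk≡0) max0-zero))
    (trans (cong₂ (λ a b → (a * M i k + max0 (- M i k) * 0#) * b + (a * M i k + max0 (- M i k) * 0#) * 0#)
      (J-ii k i≢k) (J-kk k))
    (solve 2 (λ a p → (con (ℤ.+ 1) :* a :+ p :* con (ℤ.+ 0)) :* (:- con (ℤ.+ 1))
                     :+ (con (ℤ.+ 1) :* a :+ p :* con (ℤ.+ 0)) :* con (ℤ.+ 0) := :- a)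
      refl (M i k) (max0 (- M i k)))))

  μ-offdiag : ∀ k (M : Mat) {i j} → M k k ≡ 0# → i ≢ k → j ≢ k →
              μ k M i j ≡ M i j + max0 (- M i k) * M k j + M i k * max0 (M k j)
  μ-offdiag k M {i} {j} Mkk≡0 i≢k j≢k = trans (μ-entry k M i j) (trans
    (cong₂ (λ a b → (a * M i j + max0 (- M i k) * M k j) * b + (a * M i k + max0 (- M i k) * M k k) * max0 (M k j))
      (J-ii k i≢k) (J-ii k j≢k))
    (trans (cong (λ m → (1# * M i j + max0 (- M i k) * M k j) * 1# + (1# * M i k + max0 (- M i k) * m) * max0 (M k j))
                 Mkk≡0)
    (solve 5 (λ a p b c q → (con (ℤ.+ 1) :* a :+ p :* b) :* con (ℤ.+ 1) :+ (con (ℤ.+ 1) :* c :+ p :* con (ℤ.+ 0)) :* q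
                           := a :+ p :* b :+ c :* q)
      refl (M i j) (max0 (- M i k)) (M k j) (M i k) (max0 (M k j)))))

  Cμ-col-pivot : ∀ (B C : Mat) k j → B k k ≡ 0# → Cμ B C k j k ≡ - C j k
  Cμ-col-pivot B C k j Bkk≡0 = trans (Cμ-entry B C k j k) (trans
    (cong₂ (λ a b → C j k * a + C j k * max0 b + max0 (- C j k) * b) (J-kk k) Bkk≡0)
    (trans (cong (λ m → C j k * - 1# + C j k * m + max0 (- C j k) * 0#) max0-zero)
    (solve 2 (λ c p → c :* (:- con (ℤ.+ 1)) :+ c :* con (ℤ.+ 0) :+ p :* con (ℤ.+ 0) := :- c)
      refl (C j k) (max0 (- C j k)))))

  ∣μ-row∣ : ∀ k (M : Mat) {j} → M k k ≡ 0# → j ≢ k → ∣ μ k M k j ∣ ≡ ∣ M k j ∣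
  ∣μ-row∣ k M Mkk≡0 j≢k = trans (cong ∣_∣ (μ-row k M Mkk≡0 j≢k)) (∣-i∣≡∣i∣ _)

  ∣μ-col∣ : ∀ k (M : Mat) {i} → M k k ≡ 0# → i ≢ k → ∣ μ k M i k ∣ ≡ ∣ M i k ∣
  ∣μ-col∣ k M Mkk≡0 i≢k = trans (cong ∣_∣ (μ-col k M Mkk≡0 i≢k)) (∣-i∣≡∣i∣ _)

  Cμ-col : ∀ (B C : Mat) k e {i} j → i ≢ k → 0# ≤ pmR e * C j k →
           Cμ B C k j i ≡ C j i + max0 (pmR e * B k i) * C j k
  Cμ-col B C k plus {i} j i≢k 0≤Cjk = trans (Cμ-entry B C k j i) (trans
    (cong₂ (λ a m → C j i * a + C j k * max0 (B k i) + m * B k i) (J-ii k i≢k)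
      (max0-nonpos (subst (- C j k ≤_) -0#≈0# (neg-antimono-≤ (subst (0# ≤_) (*-identityˡ (C j k)) 0≤Cjk)))))
    (trans (solve 4 (λ c d q b → c :* con (ℤ.+ 1) :+ d :* q :+ con (ℤ.+ 0) :* b := c :+ q :* d)
      refl (C j i) (C j k) (max0 (B k i)) (B k i))
    (cong (λ b → C j i + max0 b * C j k) (sym (*-identityˡ (B k i))))))
  Cμ-col B C k minus {i} j i≢k 0≤-Cjk = trans (Cμ-entry B C k j i) (trans
    (cong₂ (λ a m → C j i * a + C j k * max0 (B k i) + m * B k i) (J-ii k i≢k)
      (max0-nonneg (subst (0# ≤_) (-1*x≈-x (C j k)) 0≤-Cjk)))
    (trans (solve 4 (λ c d q b → c :* con (ℤ.+ 1) :+ d :* q :+ (:- d) :* b := c :+ (q :+ :- b) :* d)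
      refl (C j i) (C j k) (max0 (B k i)) (B k i))
    (cong (λ m → C j i + m * C j k) (trans (max0-sub (B k i)) (cong max0 (sym (-1*x≈-x (B k i))))))))

module CyclicMatrices (ℝ : RealField) where
  open RealDefs ℝ
  open OrderedField ℝ
  open MutationFormulas ℝ

  private
    sgn-cycPat : ∀ {M} → Cyclic M → ∀ {a b c d} →
                 cycPat a b ≡ flipSgn (cycPat c d) → sgn (M a b) ≡ flipSgn (sgn (M c d))
    sgn-cycPat (inj₁ M≈) {a} {b} {c} {d} eq rewrite M≈ a b | M≈ c d = eq
    sgn-cycPat (inj₂ M≈) {a} {b} {c} {d} eq rewrite M≈ a b | M≈ c d = cong flipSgn eq

    sgn-cycPat-same : ∀ {M} → Cyclic M → ∀ {a b c d} → cycPat a b ≡ cycPat c d → sgn (M a b) ≡ sgn (M c d)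
    sgn-cycPat-same (inj₁ M≈) {a} {b} {c} {d} eq rewrite M≈ a b | M≈ c d = eq
    sgn-cycPat-same (inj₂ M≈) {a} {b} {c} {d} eq rewrite M≈ a b | M≈ c d = cong flipSgn eq

  Cyclic-sgn-antisym : ∀ {M} → Cyclic M → ∀ a b → sgn (M a b) ≡ flipSgn (sgn (M b a))
  Cyclic-sgn-antisym cyc a b = sgn-cycPat cyc (cycPat-antisym a b)

  Cyclic-sgn-rowThird : ∀ {M} → Cyclic M → ∀ {a b} → a ≢ b → sgn (M a (third a b)) ≡ flipSgn (sgn (M a b))
  Cyclic-sgn-rowThird cyc a≢b = sgn-cycPat cyc (cycPat-rowThird a≢b)

  Cyclic-sgn-colThird : ∀ {M} → Cyclic M → ∀ {a b} → a ≢ b → sgn (M b (third a b)) ≡ sgn (M a b)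
  Cyclic-sgn-colThird cyc a≢b = sgn-cycPat-same cyc (cycPat-colThird a≢b)

  Cyclic-diag : ∀ {M} → Cyclic M → ∀ a → M a a ≡ 0#
  Cyclic-diag (inj₁ M≈) a = sgn≡zer⇒zero (trans (M≈ a a) (cycPat-diag a))
  Cyclic-diag (inj₂ M≈) a = sgn≡zer⇒zero (trans (M≈ a a) (cong flipSgn (cycPat-diag a)))

  Cyclic-offdiag≢zer : ∀ {M} → Cyclic M → ∀ {a b} → a ≢ b → sgn (M a b) ≢ zer
  Cyclic-offdiag≢zer (inj₁ M≈) {a} {b} a≢b sgn≡zer = cycPat-offdiag a≢b (trans (sym (M≈ a b)) sgn≡zer)
  Cyclic-offdiag≢zer (inj₂ M≈) {a} {b} a≢b sgn≡zer = cycPat-offdiag a≢b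
    (trans (sym (flipSgn-involutive _)) (cong flipSgn (trans (sym (M≈ a b)) sgn≡zer)))

  Cyclic-sgn-offdiag : ∀ {M} → Cyclic M → ∀ {a b} → a ≢ b → sgn (M a b) ≡ neg ⊎ sgn (M a b) ≡ pos
  Cyclic-sgn-offdiag {M} cyc {a} {b} a≢b with sgn (M a b) | Cyclic-offdiag≢zer cyc a≢b
  ... | neg | _    = inj₁ refl
  ... | zer | ≢zer = ⊥-elim (≢zer refl)
  ... | pos | _    = inj₂ refl

  Cyclic-∣offdiag∣-pos : ∀ {M} → Cyclic M → ∀ {a b} → a ≢ b → 0# < ∣ M a b ∣
  Cyclic-∣offdiag∣-pos cyc a≢b with Cyclic-sgn-offdiag cyc a≢b
  ... | inj₁ sgn≡neg = subst (0# <_) (sym (∣i∣≡-i (sgn≡neg⇒neg sgn≡neg))) (<0⇒0<neg (sgn≡neg⇒neg sgn≡neg))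
  ... | inj₂ sgn≡pos = subst (0# <_) (sym (∣i∣≡i (sgn≡pos⇒pos sgn≡pos))) (sgn≡pos⇒pos sgn≡pos)

  private
    ∣μ∣-when-pivot-neg : ∀ k (M : Mat) {i j} → M k k ≡ 0# → i ≢ k → j ≢ k →
      M i k < 0# → M k j < 0# → 0# < M i j → μ k M i j < 0# →
      ∣ μ k M i j ∣ ≡ ∣ M i k ∣ * ∣ M k j ∣ - ∣ M i j ∣
    ∣μ∣-when-pivot-neg k M {i} {j} Mkk≡0 i≢k j≢k Mik<0 Mkj<0 0<Mij μij<0 = begin
      ∣ μ k M i j ∣
        ≡⟨ trans (∣i∣≡-i μij<0) (cong (λ x → - x) (μ-offdiag k M Mkk≡0 i≢k j≢k)) ⟩
      - (M i j + max0 (- M i k) * M k j + M i k * max0 (M k j))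
        ≡⟨ cong₂ (λ p q → - (M i j + p * M k j + M i k * q))
                 (max0-pos (<0⇒0<neg Mik<0)) (max0-nonpos (inj₁ Mkj<0)) ⟩
      - (M i j + (- M i k) * M k j + M i k * 0#)
        ≡⟨ solve 3 (λ m p q → :- (m :+ (:- p) :* q :+ p :* con (ℤ.+ 0)) := (:- p) :* (:- q) :- m)
                   refl (M i j) (M i k) (M k j) ⟩
      (- M i k) * (- M k j) - M i j
        ≡⟨ sym (cong₂ _-_ (cong₂ _*_ (∣i∣≡-i Mik<0) (∣i∣≡-i Mkj<0)) (∣i∣≡i 0<Mij)) ⟩
      ∣ M i k ∣ * ∣ M k j ∣ - ∣ M i j ∣ ∎
      where open ≡-Reasoning

    ∣μ∣-when-pivot-pos : ∀ k (M : Mat) {i j} → M k k ≡ 0# → i ≢ k → j ≢ k →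
      0# < M i k → 0# < M k j → M i j < 0# → 0# < μ k M i j →
      ∣ μ k M i j ∣ ≡ ∣ M i k ∣ * ∣ M k j ∣ - ∣ M i j ∣
    ∣μ∣-when-pivot-pos k M {i} {j} Mkk≡0 i≢k j≢k 0<Mik 0<Mkj Mij<0 0<μij = begin
      ∣ μ k M i j ∣
        ≡⟨ trans (∣i∣≡i 0<μij) (μ-offdiag k M Mkk≡0 i≢k j≢k) ⟩
      M i j + max0 (- M i k) * M k j + M i k * max0 (M k j)
        ≡⟨ cong₂ (λ p q → M i j + p * M k j + M i k * q)
                 (max0-nonpos (inj₁ (0<⇒neg<0 0<Mik))) (max0-pos 0<Mkj) ⟩
      M i j + 0# * M k j + M i k * M k j
        ≡⟨ solve 3 (λ m p q → m :+ con (ℤ.+ 0) :* q :+ p :* q := p :* q :- (:- m))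
                   refl (M i j) (M i k) (M k j) ⟩
      M i k * M k j - (- M i j)
        ≡⟨ sym (cong₂ _-_ (cong₂ _*_ (∣i∣≡i 0<Mik) (∣i∣≡i 0<Mkj)) (∣i∣≡-i Mij<0)) ⟩
      ∣ M i k ∣ * ∣ M k j ∣ - ∣ M i j ∣ ∎
      where open ≡-Reasoning

  ∣μ-third∣ : ∀ {M} k {i} → Cyclic M → Cyclic (μ k M) → i ≢ k →
              ∣ μ k M i (third i k) ∣ ≡ ∣ M i k ∣ * ∣ M k (third i k) ∣ - ∣ M i (third i k) ∣
  ∣μ-third∣ {M} k {i} cyc cyc′ i≢k with Cyclic-sgn-offdiag cyc i≢k
  ... | inj₁ sgn≡neg = ∣μ∣-when-pivot-neg k M (Cyclic-diag cyc k) i≢k (third-≢ʳ i≢k) (sgn≡neg⇒neg sgn≡neg)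
        (sgn≡neg⇒neg (trans (Cyclic-sgn-colThird cyc i≢k) sgn≡neg))
        (sgn≡pos⇒pos (trans (Cyclic-sgn-rowThird cyc i≢k) (cong flipSgn sgn≡neg)))
        (sgn≡neg⇒neg (trans (Cyclic-sgn-rowThird cyc′ i≢k) (cong flipSgn (sgn-μ-col sgn≡neg))))
    where
    sgn-μ-col : sgn (M i k) ≡ neg → sgn (μ k M i k) ≡ pos
    sgn-μ-col sgn≡ = trans (cong sgn (μ-col k M (Cyclic-diag cyc k) i≢k)) (trans (sgn-neg _) (cong flipSgn sgn≡))
  ... | inj₂ sgn≡pos = ∣μ∣-when-pivot-pos k M (Cyclic-diag cyc k) i≢k (third-≢ʳ i≢k) (sgn≡pos⇒pos sgn≡pos)
        (sgn≡pos⇒pos (trans (Cyclic-sgn-colThird cyc i≢k) sgn≡pos))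
        (sgn≡neg⇒neg (trans (Cyclic-sgn-rowThird cyc i≢k) (cong flipSgn sgn≡pos)))
        (sgn≡pos⇒pos (trans (Cyclic-sgn-rowThird cyc′ i≢k) (cong flipSgn (sgn-μ-col sgn≡pos))))
    where
    sgn-μ-col : sgn (M i k) ≡ pos → sgn (μ k M i k) ≡ neg
    sgn-μ-col sgn≡ = trans (cong sgn (μ-col k M (Cyclic-diag cyc k) i≢k)) (trans (sgn-neg _) (cong flipSgn sgn≡))

module SignedGrowth (ℝ : RealField) where
  open RealDefs ℝ
  open OrderedField ℝ
  open MutationFormulas ℝ
  open CyclicMatrices ℝ

  record SignCoherent (C : Mat) (ε : Fin 3 → PM) : Set where
    field
      nonneg  : ∀ i j → 0# ≤ pmR (ε i) * C j i
      nonzero : ∀ i → ∃ λ j → 0# < pmR (ε i) * C j i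

  WeaklyGrows : Mat → Mat → (Fin 3 → PM) → (Fin 3 → PM) → Set
  WeaklyGrows C C′ ε ε′ = ∀ i j → pmR (ε i) * C j i ≤ pmR (ε′ i) * C′ j i

  Grows : Mat → Mat → (Fin 3 → PM) → (Fin 3 → PM) → Set
  Grows C C′ ε ε′ = WeaklyGrows C C′ ε ε′ × ∃ λ i → ∃ λ j → pmR (ε i) * C j i ≢ pmR (ε′ i) * C′ j i

  SignCoherent-grow : ∀ {C C′ ε ε′} → SignCoherent C ε → WeaklyGrows C C′ ε ε′ → SignCoherent C′ ε′
  SignCoherent-grow coh grow = record
    { nonneg  = λ i j → ≤-trans (nonneg i j) (grow i j)
    ; nonzero = λ i → let (j , 0<εc) = nonzero i in j , <-≤-trans 0<εc (grow i j) }
    where open SignCoherent coh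

  V : Mat → Mat → Fin 3 → PM → Fin 3 → Fin 3 → R
  V M C k e s j = pmR e * ((∣ M s k * M k s ∣ - 2#) * C j k + ∣ M s k ∣ * C j s)

  record Invariant (M C : Mat) (k : Fin 3) : Set where
    field
      ε         : Fin 3 → PM
      coherent  : SignCoherent C ε
      s         : Fin 3
      s≢k       : s ≢ k
      εk≡-εs    : ε k ≡ flipPM (ε s)
      sgn-Mks   : sgn (M k s) ≡ flipSgn (pmS (ε s))
      V-nonneg  : ∀ j → 0# ≤ V M C k (ε s) s j
      V-nonzero : ∃ λ j → 0# < V M C k (ε s) s j

  Grows-resp : ∀ {C C′ D′ ε ε′ δ δ′} → (∀ i → ε i ≡ δ i) → (∀ i → ε′ i ≡ δ′ i) → C′ ≡ D′ →
               Grows C C′ δ δ′ → Grows C D′ ε ε′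
  Grows-resp {C} {C′} ε≡δ ε′≡δ′ refl (weak , i , j , ≢) =
    (λ i j → subst₂ _≤_ (old i j) (new i j) (weak i j)) ,
    i , j , λ eq → ≢ (trans (old i j) (trans eq (sym (new i j))))
    where
    old = λ i j → cong (λ e → pmR e * C j i) (sym (ε≡δ i))
    new = λ i j → cong (λ e → pmR e * C′ j i) (sym (ε′≡δ′ i))

  flipAt : Fin 3 → (Fin 3 → PM) → Fin 3 → PM
  flipAt t ε i with i ≟ t
  ... | yes _ = flipPM (ε i)
  ... | no _  = ε i

  swapAt : Fin 3 → Fin 3 → (Fin 3 → PM) → Fin 3 → PM
  swapAt k s ε i with i ≟ k | i ≟ s
  ... | yes _ | _     = ε s
  ... | no _  | yes _ = ε k
  ... | no _  | no _  = ε i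

  flipAt-on : ∀ t ε → flipAt t ε t ≡ flipPM (ε t)
  flipAt-on t ε with t ≟ t
  ... | yes _   = refl
  ... | no t≢t = ⊥-elim (t≢t refl)

  flipAt-off : ∀ t ε {i} → i ≢ t → flipAt t ε i ≡ ε i
  flipAt-off t ε {i} i≢t with i ≟ t
  ... | yes i≡t = ⊥-elim (i≢t i≡t)
  ... | no _    = refl

  swapAt-k : ∀ k s ε → swapAt k s ε k ≡ ε s
  swapAt-k k s ε with k ≟ k
  ... | yes _   = refl
  ... | no k≢k = ⊥-elim (k≢k refl)

  swapAt-s : ∀ k s ε → s ≢ k → swapAt k s ε s ≡ ε k
  swapAt-s k s ε s≢k with s ≟ k | s ≟ s
  ... | yes s≡k | _      = ⊥-elim (s≢k s≡k)
  ... | no _    | yes _  = refl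
  ... | no _    | no s≢s = ⊥-elim (s≢s refl)

  swapAt-off : ∀ k s ε {i} → i ≢ k → i ≢ s → swapAt k s ε i ≡ ε i
  swapAt-off k s ε {i} i≢k i≢s with i ≟ k | i ≟ s
  ... | yes i≡k | _       = ⊥-elim (i≢k i≡k)
  ... | no _    | yes i≡s = ⊥-elim (i≢s i≡s)
  ... | no _    | no _    = refl

  -- Mutation at t when cₜ and cᵣ have the same tropical sign and bₜᵣ, bₜₒ have signs εᵣ, -εᵣ:
  -- cₜ changes sign, cᵣ grows by the nonnegative multiple εᵣbₜᵣ of cₜ, and cₒ is unchanged.
  module ConcordantStep (M C : Mat) (ε : Fin 3 → PM) {t r o : Fin 3} (coh : SignCoherent C ε)
    (r≢t : r ≢ t) (o≢t : o ≢ t) (o≢r : o ≢ r) (Mtt≡0 : M t t ≡ 0#) (εt≡εr : ε t ≡ ε r)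
    (sgn-Mtr : sgn (M t r) ≡ pmS (ε r)) (sgn-Mto : sgn (M t o) ≡ flipSgn (pmS (ε r))) where

    open SignCoherent coh

    private
      ε′ = flipAt t ε
      M′ = μ t M
      C′ = Cμ M C t

      z = pmR (ε r) * M t r
      0<z : 0# < z
      0<z = pmR*-pos (ε r) sgn-Mtr

      T : Fin 3 → R
      T j = pmR (ε t) * C j t

      max0-εt*Mtr : max0 (pmR (ε t) * M t r) ≡ z
      max0-εt*Mtr = trans (cong (λ e → max0 (pmR e * M t r)) εt≡εr) (max0-pos 0<z)

      max0-εt*Mto : max0 (pmR (ε t) * M t o) ≡ 0#
      max0-εt*Mto = trans (cong (λ e → max0 (pmR e * M t o)) εt≡εr) (max0-nonpos (inj₁ (pmR*-neg (ε r) sgn-Mto)))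

      signed-t : ∀ j → pmR (ε′ t) * C′ j t ≡ T j
      signed-t j = trans (cong₂ (λ e c → pmR e * c) (flipAt-on t ε) (Cμ-col-pivot M C t j Mtt≡0))
        (trans (cong (_* - C j t) (pmR-flipPM (ε t))) (neg*neg _ _))

      signed-r : ∀ j → pmR (ε′ r) * C′ j r ≡ pmR (ε r) * C j r + z * T j
      signed-r j = begin
        pmR (ε′ r) * C′ j r
          ≡⟨ cong₂ (λ e c → pmR e * c) (flipAt-off t ε r≢t) (Cμ-col M C t (ε t) j r≢t (nonneg t j)) ⟩
        pmR (ε r) * (C j r + max0 (pmR (ε t) * M t r) * C j t)
          ≡⟨ cong (λ m → pmR (ε r) * (C j r + m * C j t)) max0-εt*Mtr ⟩
        pmR (ε r) * (C j r + z * C j t)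
          ≡⟨ solve 4 (λ e c z d → e :* (c :+ z :* d) := e :* c :+ z :* (e :* d)) refl (pmR (ε r)) (C j r) z (C j t) ⟩
        pmR (ε r) * C j r + z * (pmR (ε r) * C j t)
          ≡⟨ cong (λ e → pmR (ε r) * C j r + z * (pmR e * C j t)) (sym εt≡εr) ⟩
        pmR (ε r) * C j r + z * T j ∎
        where open ≡-Reasoning

      signed-o : ∀ j → pmR (ε′ o) * C′ j o ≡ pmR (ε o) * C j o
      signed-o j = cong₂ (λ e c → pmR e * c) (flipAt-off t ε o≢t)
        (trans (Cμ-col M C t (ε t) j o≢t (nonneg t j))
          (trans (cong (λ m → C j o + m * C j t) max0-εt*Mto) (trans (cong (C j o +_) (zeroˡ _)) (+-identityʳ _))))

    grows : Grows C C′ ε ε′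
    grows = weak , r , strict
      where
      weak : WeaklyGrows C C′ ε ε′
      weak i j with distinct-cover (λ t≡r → r≢t (sym t≡r)) o≢t o≢r i
      ... | inj₁ refl        = inj₂ (sym (signed-t j))
      ... | inj₂ (inj₁ refl) = subst (pmR (ε r) * C j r ≤_) (sym (signed-r j))
                                 (x≤x+δ (nonneg*nonneg (inj₁ 0<z) (nonneg t j)))
      ... | inj₂ (inj₂ refl) = inj₂ (sym (signed-o j))
      strict : ∃ λ j → pmR (ε r) * C j r ≢ pmR (ε′ r) * C′ j r
      strict = let (j , 0<Tj) = nonzero t in j , λ eq → x≢x+δ (*-pos 0<z 0<Tj) (trans eq (signed-r j))

    private
      V-value : ∀ j → V M′ C′ t (ε′ r) r j ≡ (T j + T j) + ∣ M r t ∣ * (pmR (ε r) * C j r)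
      V-value j = begin
        pmR (ε′ r) * ((∣ M′ r t * M′ t r ∣ - 2#) * C′ j t + ∣ M′ r t ∣ * C′ j r)
          ≡⟨ cong₂ (λ e w → pmR e * w) (flipAt-off t ε r≢t) (cong₂ _+_
               (cong₂ (λ p c → (p - 2#) * c) ∣M′rt*M′tr∣ (Cμ-col-pivot M C t j Mtt≡0))
               (cong₂ _*_ (trans (cong ∣_∣ M′rt) (∣-i∣≡∣i∣ _)) C′jr)) ⟩
        pmR (ε r) * ((∣ M r t ∣ * z - 2#) * (- C j t) + ∣ M r t ∣ * (C j r + z * C j t))
          ≡⟨ solve 5 (λ e c d u z → e :* ((u :* z :- con (ℤ.+ 2)) :* (:- c) :+ u :* (d :+ z :* c))
                                    := (e :* c :+ e :* c) :+ u :* (e :* d)) refl (pmR (ε r)) (C j t) (C j r) ∣ M r t ∣ z ⟩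
        (pmR (ε r) * C j t + pmR (ε r) * C j t) + ∣ M r t ∣ * (pmR (ε r) * C j r)
          ≡⟨ cong (λ e → (pmR e * C j t + pmR e * C j t) + ∣ M r t ∣ * (pmR (ε r) * C j r)) (sym εt≡εr) ⟩
        (T j + T j) + ∣ M r t ∣ * (pmR (ε r) * C j r) ∎
        where
        open ≡-Reasoning
        M′rt : M′ r t ≡ - M r t
        M′rt = μ-col t M Mtt≡0 r≢t
        ∣M′rt*M′tr∣ : ∣ M′ r t * M′ t r ∣ ≡ ∣ M r t ∣ * z
        ∣M′rt*M′tr∣ = trans (cong ∣_∣ (trans (cong₂ _*_ M′rt (μ-row t M Mtt≡0 r≢t)) (neg*neg _ _)))
          (trans (∣i*j∣≡∣i∣*∣j∣ _ _) (cong (∣ M r t ∣ *_) (∣i∣≡pmR* (ε r) sgn-Mtr)))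
        C′jr : C′ j r ≡ C j r + z * C j t
        C′jr = trans (Cμ-col M C t (ε t) j r≢t (nonneg t j)) (cong (λ m → C j r + m * C j t) max0-εt*Mtr)

    invariant : Invariant M′ C′ t
    invariant = record
      { ε         = ε′
      ; coherent  = SignCoherent-grow coh (proj₁ grows)
      ; s         = r
      ; s≢k       = r≢t
      ; εk≡-εs    = trans (flipAt-on t ε) (cong flipPM (trans εt≡εr (sym (flipAt-off t ε r≢t))))
      ; sgn-Mks   = trans (cong sgn (μ-row t M Mtt≡0 r≢t)) (trans (sgn-neg _)
                      (cong flipSgn (trans sgn-Mtr (cong pmS (sym (flipAt-off t ε r≢t))))))
      ; V-nonneg  = λ j → subst (0# ≤_) (sym (V-value j))
                      (nonneg+nonneg (nonneg+nonneg (nonneg t j) (nonneg t j)) (nonneg*nonneg (0≤∣i∣ _) (nonneg r j)))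
      ; V-nonzero = let (j , 0<Tj) = nonzero t in j , subst (0# <_) (sym (V-value j))
                      (pos+nonneg (pos+nonneg 0<Tj (nonneg t j)) (nonneg*nonneg (0≤∣i∣ _) (nonneg r j)))
      }

  module PartnerSigns {M C : Mat} {k : Fin 3} (inv : Invariant M C k) (cyc : Cyclic M) where
    open Invariant inv

    sgn-Msk : sgn (M s k) ≡ pmS (ε s)
    sgn-Msk = trans (Cyclic-sgn-antisym cyc s k) (trans (cong flipSgn sgn-Mks) (flipSgn-involutive _))

    sgn-Mst : sgn (M s (third k s)) ≡ flipSgn (pmS (ε s))
    sgn-Mst = trans (cong (λ i → sgn (M s i)) (third-comm k s))
      (trans (Cyclic-sgn-rowThird cyc s≢k) (cong flipSgn sgn-Msk))

  module PartnerStep (M C : Mat) {k : Fin 3} (inv : Invariant M C k) (cyc : Cyclic M)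
    (2≤ : 2# ≤ ∣ M (Invariant.s inv) k ∣ * ∣ M k (Invariant.s inv) ∣ - 2#) where

    open Invariant inv
    open SignCoherent coherent
    open PartnerSigns inv cyc

    private
      k≢s : k ≢ s
      k≢s k≡s = s≢k (sym k≡s)
      t = third k s
      t≢k = third-≢ˡ k≢s
      t≢s = third-≢ʳ k≢s

      ε′ = swapAt k s ε
      M′ = μ s M
      C′ = Cμ M C s
      Mss≡0 = Cyclic-diag cyc s

      e = pmR (ε s)
      x = e * M s k
      0<x : 0# < x
      0<x = pmR*-pos (ε s) sgn-Msk
      ∣Msk∣≡x : ∣ M s k ∣ ≡ x
      ∣Msk∣≡x = ∣i∣≡pmR* (ε s) sgn-Msk
      y = ∣ M k s ∣

      D = (x * y - 2#) - 2#
      0≤D : 0# ≤ D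
      0≤D = ≤⇒0≤diff (subst (λ u → 2# ≤ u * y - 2#) ∣Msk∣≡x 2≤)

      K : Fin 3 → R
      K j = pmR (ε k) * C j k
      K≡ : ∀ j → K j ≡ - e * C j k
      K≡ j = cong (_* C j k) (trans (cong pmR εk≡-εs) (pmR-flipPM (ε s)))

      W : Fin 3 → R
      W j = e * ((x * y - 2#) * C j k + x * C j s)
      V≡W : ∀ j → V M C k (ε s) s j ≡ W j
      V≡W j = cong (e *_) (cong₂ (λ p q → (p - 2#) * C j k + q * C j s)
        (trans (∣i*j∣≡∣i∣*∣j∣ _ _) (cong (_* y) ∣Msk∣≡x)) ∣Msk∣≡x)
      0≤W : ∀ j → 0# ≤ W j
      0≤W j = subst (0# ≤_) (V≡W j) (V-nonneg j)

      C′jk : ∀ j → C′ j k ≡ C j k + x * C j s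
      C′jk j = trans (Cμ-col M C s (ε s) j k≢s (nonneg s j)) (cong (λ m → C j k + m * C j s) (max0-pos 0<x))

      signed-k : ∀ j → pmR (ε′ k) * C′ j k ≡ K j + (W j + D * K j)
      signed-k j = trans (cong₂ (λ e c → pmR e * c) (swapAt-k k s ε) (C′jk j))
        (trans (solve 5 (λ e x y c d → e :* (c :+ x :* d) :=
                   (:- e :* c) :+ (e :* ((x :* y :- con (ℤ.+ 2)) :* c :+ x :* d)
                                   :+ (x :* y :- con (ℤ.+ 2) :- con (ℤ.+ 2)) :* (:- e :* c))) refl
                 e x y (C j k) (C j s))
          (cong (λ u → u + (W j + D * u)) (sym (K≡ j))))

      signed-s : ∀ j → pmR (ε′ s) * C′ j s ≡ pmR (ε s) * C j s
      signed-s j = trans (cong₂ (λ e c → pmR e * c) (swapAt-s k s ε s≢k) (Cμ-col-pivot M C s j Mss≡0))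
        (trans (cong (λ e → pmR e * - C j s) εk≡-εs) (trans (cong (_* - C j s) (pmR-flipPM (ε s))) (neg*neg _ _)))

      signed-t : ∀ j → pmR (ε′ t) * C′ j t ≡ pmR (ε t) * C j t
      signed-t j = cong₂ (λ e c → pmR e * c) (swapAt-off k s ε t≢k t≢s)
        (trans (Cμ-col M C s (ε s) j t≢s (nonneg s j))
          (trans (cong (λ m → C j t + m * C j s) (max0-nonpos (inj₁ (pmR*-neg (ε s) sgn-Mst))))
            (trans (cong (C j t +_) (zeroˡ _)) (+-identityʳ _))))

    grows : Grows C C′ ε ε′
    grows = weak , k , strict
      where
      weak : WeaklyGrows C C′ ε ε′
      weak i j with distinct-cover k≢s t≢k t≢s i
      ... | inj₁ refl        = subst (K j ≤_) (sym (signed-k j))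
                                 (x≤x+δ (nonneg+nonneg (0≤W j) (nonneg*nonneg 0≤D (nonneg k j))))
      ... | inj₂ (inj₁ refl) = inj₂ (sym (signed-s j))
      ... | inj₂ (inj₂ refl) = inj₂ (sym (signed-t j))
      strict : ∃ λ j → K j ≢ pmR (ε′ k) * C′ j k
      strict = let (j , 0<V) = V-nonzero in j , λ eq → x≢x+δ
        (pos+nonneg (subst (0# <_) (V≡W j) 0<V) (nonneg*nonneg 0≤D (nonneg k j))) (trans eq (signed-k j))

    private
      x*V′-value : ∀ j → x * V M′ C′ s (ε′ k) k j ≡ (W j + W j) + D * K j
      x*V′-value j = begin
        x * (pmR (ε′ k) * ((∣ M′ k s * M′ s k ∣ - 2#) * C′ j s + ∣ M′ k s ∣ * C′ j k))
          ≡⟨ cong (x *_) (cong₂ (λ e w → pmR e * w) (swapAt-k k s ε) (cong₂ _+_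
               (cong₂ (λ p c → (p - 2#) * c) ∣M′ks*M′sk∣ (Cμ-col-pivot M C s j Mss≡0))
               (cong₂ _*_ (trans (cong ∣_∣ M′ks) (∣-i∣≡∣i∣ _)) (C′jk j)))) ⟩
        x * (e * ((y * x - 2#) * (- C j s) + y * (C j k + x * C j s)))
          ≡⟨ solve 5 (λ e x y c d → x :* (e :* ((y :* x :- con (ℤ.+ 2)) :* (:- d) :+ y :* (c :+ x :* d))) :=
                       (e :* ((x :* y :- con (ℤ.+ 2)) :* c :+ x :* d) :+ e :* ((x :* y :- con (ℤ.+ 2)) :* c :+ x :* d))
                       :+ (x :* y :- con (ℤ.+ 2) :- con (ℤ.+ 2)) :* (:- e :* c)) refl e x y (C j k) (C j s) ⟩
        (W j + W j) + D * (- e * C j k)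
          ≡⟨ cong (λ u → (W j + W j) + D * u) (sym (K≡ j)) ⟩
        (W j + W j) + D * K j ∎
        where
        open ≡-Reasoning
        M′ks : M′ k s ≡ - M k s
        M′ks = μ-col s M Mss≡0 k≢s
        ∣M′ks*M′sk∣ : ∣ M′ k s * M′ s k ∣ ≡ y * x
        ∣M′ks*M′sk∣ = trans (cong ∣_∣ (trans (cong₂ _*_ M′ks (μ-row s M Mss≡0 k≢s)) (neg*neg _ _)))
          (trans (∣i*j∣≡∣i∣*∣j∣ _ _) (cong (y *_) ∣Msk∣≡x))

    invariant : Invariant M′ C′ s
    invariant = record
      { ε         = ε′
      ; coherent  = SignCoherent-grow coherent (proj₁ grows)
      ; s         = k
      ; s≢k       = k≢s
      ; εk≡-εs    = trans (swapAt-s k s ε s≢k) (trans εk≡-εs (cong flipPM (sym (swapAt-k k s ε))))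
      ; sgn-Mks   = trans (cong sgn (μ-row s M Mss≡0 k≢s)) (trans (sgn-neg _)
                      (cong flipSgn (trans sgn-Msk (cong pmS (sym (swapAt-k k s ε))))))
      ; V-nonneg  = λ j → *-cancelˡ-nonneg 0<x (subst (0# ≤_) (sym (x*V′-value j))
                      (nonneg+nonneg (nonneg+nonneg (0≤W j) (0≤W j)) (nonneg*nonneg 0≤D (nonneg k j))))
      ; V-nonzero = let (j , 0<V) = V-nonzero ; 0<W = subst (0# <_) (V≡W j) 0<V in
                    j , *-cancelˡ-pos 0<x (subst (0# <_) (sym (x*V′-value j))
                      (pos+nonneg (pos+nonneg 0<W (0≤W j)) (nonneg*nonneg 0≤D (nonneg k j))))
      }

  InvariantStep : Mat → Mat → (Fin 3 → PM) → Fin 3 → Set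
  InvariantStep M C ε k′ =
    Σ (Invariant (μ k′ M) (Cμ M C k′) k′) λ inv′ → Grows C (Cμ M C k′) ε (Invariant.ε inv′)

  module ThirdStep (M C : Mat) {k : Fin 3} (inv : Invariant M C k) (cyc : Cyclic M) where

    open Invariant inv
    open PartnerSigns inv cyc

    private
      k≢s : k ≢ s
      k≢s k≡s = s≢k (sym k≡s)
      t = third k s
      t≢k = third-≢ˡ k≢s
      t≢s = third-≢ʳ k≢s
      s≢t : s ≢ t
      s≢t s≡t = t≢s (sym s≡t)
      k≢t : k ≢ t
      k≢t k≡t = t≢k (sym k≡t)

      sgn-Mts : sgn (M t s) ≡ pmS (ε s)
      sgn-Mts = trans (Cyclic-sgn-antisym cyc t s) (trans (cong flipSgn sgn-Mst) (flipSgn-involutive _))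

      sgn-Mtk : sgn (M t k) ≡ flipSgn (pmS (ε s))
      sgn-Mtk = trans (Cyclic-sgn-antisym cyc t k) (cong flipSgn
        (trans (Cyclic-sgn-rowThird cyc k≢s) (trans (cong flipSgn sgn-Mks) (flipSgn-involutive _))))

      pmS-εk : pmS (ε k) ≡ flipSgn (pmS (ε s))
      pmS-εk = trans (cong pmS εk≡-εs) (sym (flipSgn-pmS (ε s)))

    third-step : InvariantStep M C ε t
    third-step with ≡⊎≡flipPM (ε t) (ε s)
    ... | inj₁ εt≡εs = invariant , grows
      where open ConcordantStep M C ε coherent s≢t k≢t k≢s (Cyclic-diag cyc t) εt≡εs sgn-Mts sgn-Mtk
    ... | inj₂ εt≡-εs = invariant , grows
      where
      open ConcordantStep M C ε coherent k≢t s≢t s≢k (Cyclic-diag cyc t) (trans εt≡-εs (sym εk≡-εs))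
        (trans sgn-Mtk (sym pmS-εk))
        (trans sgn-Mts (trans (sym (flipSgn-involutive _)) (cong flipSgn (sym pmS-εk))))

  μ-invariant : ∀ (M C : Mat) {k} (inv : Invariant M C k) → Cyclic M →
                2# ≤ ∣ M (Invariant.s inv) k ∣ * ∣ M k (Invariant.s inv) ∣ - 2# →
                ∀ k′ → k′ ≢ k → InvariantStep M C (Invariant.ε inv) k′
  μ-invariant M C inv cyc 2≤ k′ k′≢k with k′ ≟ Invariant.s inv
  ... | yes refl = PartnerStep.invariant M C inv cyc 2≤ , PartnerStep.grows M C inv cyc 2≤
  ... | no k′≢s with third-unique (λ k≡s → Invariant.s≢k inv (sym k≡s)) k′≢k k′≢s
  ... | refl = ThirdStep.third-step M C inv cyc

module AlternatingMutation (ℝ : RealField) where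
  open RealDefs ℝ
  open OrderedField ℝ
  open MutationFormulas ℝ
  open CyclicMatrices ℝ

  BC-∷ʳ : ∀ B w a → BC B (w ∷ʳ a) ≡ step (BC B w) a
  BC-∷ʳ B w a = foldl-∷ʳ step (B , Id) a w

  Bw-∷ʳ : ∀ B w a → Bw B (w ∷ʳ a) ≡ μ a (Bw B w)
  Bw-∷ʳ B w a = cong proj₁ (BC-∷ʳ B w a)

  Cw-∷ʳ : ∀ B w a → Cw B (w ∷ʳ a) ≡ Cμ (Bw B w) (Cw B w) a
  Cw-∷ʳ B w a = cong proj₂ (BC-∷ʳ B w a)

  module Alternation (B : Mat) (cc : ClusterCyclic B) (v : List (Fin 3)) {k s : Fin 3}
                     (red : Reduced (v ∷ʳ k)) (s≢k : s ≢ k) where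
    private
      k≢s : k ≢ s
      k≢s k≡s = s≢k (sym k≡s)
      t = third k s
      t≢s = third-≢ʳ k≢s
      s≢t : s ≢ t
      s≢t s≡t = t≢s (sym s≡t)

      prefix : ℕ → List (Fin 3)
      prefix ℕ.zero    = v
      prefix (ℕ.suc n) = (prefix n ∷ʳ k) ∷ʳ s

      reduced : ∀ n → Reduced (prefix n ∷ʳ k)
      reduced ℕ.zero    = red
      reduced (ℕ.suc n) = Reduced-snoc (prefix n ∷ʳ k) s k (Reduced-snoc (prefix n) k s (reduced n) k≢s) s≢k

      M N : ℕ → Mat
      M n = Bw B (prefix n ∷ʳ k)
      N n = Bw B ((prefix n ∷ʳ k) ∷ʳ s)

      cycM : ∀ n → Cyclic (M n)
      cycM n = cc _ (reduced n)

      cycN : ∀ n → Cyclic (N n)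
      cycN n = cc _ (Reduced-snoc (prefix n) k s (reduced n) k≢s)

      N≡μM : ∀ n → N n ≡ μ s (M n)
      N≡μM n = Bw-∷ʳ B (prefix n ∷ʳ k) s

      M-suc≡μN : ∀ n → M (ℕ.suc n) ≡ μ k (N n)
      M-suc≡μN n = Bw-∷ʳ B ((prefix n ∷ʳ k) ∷ʳ s) k

      ∣N∣ : ∀ n i j → ∣ N n i j ∣ ≡ ∣ μ s (M n) i j ∣
      ∣N∣ n i j = cong (λ A → ∣ A i j ∣) (N≡μM n)

      ∣M-suc∣ : ∀ n i j → ∣ M (ℕ.suc n) i j ∣ ≡ ∣ μ k (N n) i j ∣
      ∣M-suc∣ n i j = cong (λ A → ∣ A i j ∣) (M-suc≡μN n)

      Mss≡0 = λ n → Cyclic-diag (cycM n) s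
      Nkk≡0 = λ n → Cyclic-diag (cycN n) k

      x y : R
      x = ∣ M 0 s k ∣
      y = ∣ M 0 k s ∣

      ∣Msk∣ : ∀ n → ∣ M n s k ∣ ≡ x
      ∣Msk∣ ℕ.zero    = refl
      ∣Msk∣ (ℕ.suc n) = trans (∣M-suc∣ n s k) (trans (∣μ-col∣ k (N n) (Nkk≡0 n) s≢k)
        (trans (∣N∣ n s k) (trans (∣μ-row∣ s (M n) (Mss≡0 n) k≢s) (∣Msk∣ n))))

      ∣Mks∣ : ∀ n → ∣ M n k s ∣ ≡ y
      ∣Mks∣ ℕ.zero    = refl
      ∣Mks∣ (ℕ.suc n) = trans (∣M-suc∣ n k s) (trans (∣μ-row∣ k (N n) (Nkk≡0 n) s≢k)
        (trans (∣N∣ n k s) (trans (∣μ-col∣ s (M n) (Mss≡0 n) k≢s) (∣Mks∣ n))))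

      b β : ℕ → R
      b n = ∣ M n k t ∣
      β n = ∣ N n k t ∣

    a : ℕ → R
    a n = ∣ M n s t ∣

    a-pos : ∀ n → 0# < a n
    a-pos n = Cyclic-∣offdiag∣-pos (cycM n) s≢t

    private
      β≡ : ∀ n → β n ≡ y * a n - b n
      β≡ n = trans (∣N∣ n k t) (trans (∣μ-third∣ s (cycM n) (subst Cyclic (N≡μM n) (cycN n)) k≢s)
        (cong (λ u → u * a n - b n) (∣Mks∣ n)))

      a-suc : ∀ n → a (ℕ.suc n) ≡ x * β n - a n
      a-suc n = begin
        ∣ M (ℕ.suc n) s t ∣                        ≡⟨ ∣M-suc∣ n s t ⟩
        ∣ μ k (N n) s t ∣                          ≡⟨ cong (λ i → ∣ μ k (N n) s i ∣) (third-comm k s) ⟩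
        ∣ μ k (N n) s (third s k) ∣                ≡⟨ ∣μ-third∣ k (cycN n) (subst Cyclic (M-suc≡μN n) (cycM (ℕ.suc n))) s≢k ⟩
        ∣ N n s k ∣ * ∣ N n k (third s k) ∣ - ∣ N n s (third s k) ∣
          ≡⟨ cong (λ i → ∣ N n s k ∣ * ∣ N n k i ∣ - ∣ N n s i ∣) (third-comm s k) ⟩
        ∣ N n s k ∣ * β n - ∣ N n s t ∣
          ≡⟨ cong₂ (λ u w → u * β n - w)
               (trans (∣N∣ n s k) (trans (∣μ-row∣ s (M n) (Mss≡0 n) k≢s) (∣Msk∣ n)))
               (trans (∣N∣ n s t) (∣μ-row∣ s (M n) (Mss≡0 n) t≢s)) ⟩
        x * β n - a n ∎
        where open ≡-Reasoning

      b-suc : ∀ n → b (ℕ.suc n) ≡ β n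
      b-suc n = trans (∣M-suc∣ n k t) (∣μ-row∣ k (N n) (Nkk≡0 n) (third-≢ˡ k≢s))

    a-rec : ∀ n → a (ℕ.suc (ℕ.suc n)) ≡ (x * y - 2#) * a (ℕ.suc n) - a n
    a-rec n = begin
      a (ℕ.suc (ℕ.suc n))                                  ≡⟨ a-suc (ℕ.suc n) ⟩
      x * β (ℕ.suc n) - a (ℕ.suc n)                        ≡⟨ cong (λ u → x * u - a (ℕ.suc n))
                                                               (trans (β≡ (ℕ.suc n)) (cong (λ u → y * a (ℕ.suc n) - u) (b-suc n))) ⟩
      x * (y * a (ℕ.suc n) - β n) - a (ℕ.suc n)            ≡⟨ cong (λ u → x * (y * u - β n) - u) (a-suc n) ⟩
      x * (y * (x * β n - a n) - β n) - (x * β n - a n)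
        ≡⟨ solve 4 (λ x y β a → x :* (y :* (x :* β :- a) :- β) :- (x :* β :- a)
                                := (x :* y :- con (ℤ.+ 2)) :* (x :* β :- a) :- a) refl x y (β n) (a n) ⟩
      (x * y - 2#) * (x * β n - a n) - a n                 ≡⟨ cong (λ u → (x * y - 2#) * u - a n) (sym (a-suc n)) ⟩
      (x * y - 2#) * a (ℕ.suc n) - a n                     ∎
      where open ≡-Reasoning

  partner-product≥4 : ∀ B → ClusterCyclic B → ∀ v {k s} → Reduced (v ∷ʳ k) → s ≢ k →
                      2# ≤ ∣ Bw B (v ∷ʳ k) s k ∣ * ∣ Bw B (v ∷ʳ k) k s ∣ - 2#
  partner-product≥4 B cc v red s≢k = positive-recurrence⇒2≤ _ a a-pos a-rec
    where open Alternation B cc v red s≢k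

module Invariance (ℝ : RealField) where
  open RealDefs ℝ
  open OrderedField ℝ
  open MutationFormulas ℝ
  open CyclicMatrices ℝ
  open SignedGrowth ℝ
  open AlternatingMutation ℝ

  Id-coherent : SignCoherent Id (λ _ → plus)
  Id-coherent = record
    { nonneg  = λ i j → subst (0# ≤_) (sym (*-identityˡ (Id j i))) (Id-nonneg j i)
    ; nonzero = λ i → i , subst (0# <_) (sym (trans (*-identityˡ (Id i i)) (Id-diag i))) 0<1 }
    where
    Id-nonneg : ∀ j i → 0# ≤ Id j i
    Id-nonneg j i with j ≟ i
    ... | yes _ = inj₁ 0<1
    ... | no _  = inj₂ refl
    Id-diag : ∀ i → Id i i ≡ 1#
    Id-diag i with i ≟ i
    ... | yes _   = refl
    ... | no i≢i = ⊥-elim (i≢i refl)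

  initial-invariant : ∀ B → Cyclic B → ∀ k → Invariant (μ k B) (Cμ B Id k) k
  initial-invariant B cyc k = from-sign (Cyclic-sgn-offdiag cyc k≢r)
    where
    r = next k
    k≢r : k ≢ r
    k≢r k≡r = next≢ k (sym k≡r)
    o≢k = third-≢ˡ k≢r
    o≢r = third-≢ʳ k≢r
    sgn-Bko = Cyclic-sgn-rowThird cyc k≢r

    from-sign : sgn (B k r) ≡ neg ⊎ sgn (B k r) ≡ pos → Invariant (μ k B) (Cμ B Id k) k
    from-sign (inj₂ sgn≡pos) = ConcordantStep.invariant B Id (λ _ → plus) Id-coherent (next≢ k) o≢k o≢r
      (Cyclic-diag cyc k) refl sgn≡pos (trans sgn-Bko (cong flipSgn sgn≡pos))
    from-sign (inj₁ sgn≡neg) = ConcordantStep.invariant B Id (λ _ → plus) Id-coherent o≢k (next≢ k)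
      (λ r≡o → o≢r (sym r≡o)) (Cyclic-diag cyc k) refl (trans sgn-Bko (cong flipSgn sgn≡neg)) sgn≡neg

  invariant : ∀ B → ClusterCyclic B → ∀ v k → Reduced (v ∷ʳ k) → Invariant (Bw B (v ∷ʳ k)) (Cw B (v ∷ʳ k)) k
  invariant B cc v = along (reverseView v)
    where
    along : ∀ {v} → Reverse v → ∀ k → Reduced (v ∷ʳ k) → Invariant (Bw B (v ∷ʳ k)) (Cw B (v ∷ʳ k)) k
    along [] k _ = initial-invariant B (cc [] _) k
    along (u ∶ rev ∶ʳ x) k red = subst (λ BC′ → Invariant (proj₁ BC′) (proj₂ BC′) k) (sym (BC-∷ʳ B (u ∷ʳ x) k))
      (proj₁ (μ-invariant _ _ inv (cc (u ∷ʳ x) red′) (partner-product≥4 B cc u red′ (Invariant.s≢k inv))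
        k (λ k≡x → Reduced-last u x k red (sym k≡x))))
      where
      red′ = Reduced-init (u ∷ʳ x) k red
      inv = along rev x red′

  module _ (B : Mat) (cc : ClusterCyclic B) (v : List (Fin 3)) (k : Fin 3) (red : Reduced (v ∷ʳ k))
           (ε : Fin 3 → PM) (tropical : TropSigns B (v ∷ʳ k) ε) where

    private
      M = Bw B (v ∷ʳ k)
      C = Cw B (v ∷ʳ k)
      inv = invariant B cc v k red
      open Invariant inv renaming (ε to ε₀)
      cyc = cc (v ∷ʳ k) red
      k≢s : k ≢ s
      k≢s k≡s = s≢k (sym k≡s)

      ε≡ε₀ : ∀ i → ε i ≡ ε₀ i
      ε≡ε₀ i = pmR*-uniqueness (λ j → C j i) (tropical i) (SignCoherent.nonzero coherent i)

      sgnR-Mkt : sgnR (M k (third k s)) ≡ pmR (ε₀ s)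
      sgnR-Mkt = sgnR≡pmR (ε₀ s)
        (trans (Cyclic-sgn-rowThird cyc k≢s) (trans (cong flipSgn sgn-Mks) (flipSgn-involutive _)))

    V-nonneg-at : (s′ : Fin 3) → s′ ≢ k → pmR (ε s′) * sgnR (M k s′) ≡ - 1# → ε k ≢ ε s′ →
                  ∀ j → 0# ≤ V M C k (ε s′) s′ j
    V-nonneg-at s′ s′≢k sign ε≢ j with s′ ≟ s
    ... | yes refl = subst (λ e → 0# ≤ V M C k e s j) (sym (ε≡ε₀ s)) (V-nonneg j)
    ... | no s′≢s with third-unique k≢s s′≢k s′≢s
    ... | refl = ⊥-elim (ε≢ (trans (ε≡ε₀ k) (trans εk≡-εs (sym (pmR*pmR≡-1 (ε s′) (ε₀ s)
                   (trans (cong (pmR (ε s′) *_) (sym sgnR-Mkt)) sign))))))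

    grows-at : (k′ : Fin 3) → k′ ≢ k → (ε′ : Fin 3 → PM) → TropSigns B (extend (v ∷ʳ k) k′) ε′ →
               Grows C (Cw B (extend (v ∷ʳ k) k′)) ε ε′
    grows-at k′ k′≢k ε′ tropical′ = Grows-resp ε≡ε₀ ε′≡ (sym C′≡) grows
      where
      C′≡ : Cw B (extend (v ∷ʳ k) k′) ≡ Cμ M C k′
      C′≡ = trans (cong (Cw B) (extend-snoc v k k′ k′≢k)) (Cw-∷ʳ B (v ∷ʳ k) k′)
      step′ = μ-invariant M C inv cyc (partner-product≥4 B cc v red s≢k) k′ k′≢k
      grows = proj₂ step′
      ε′≡ : ∀ i → ε′ i ≡ Invariant.ε (proj₁ step′) i
      ε′≡ i = pmR*-uniqueness (λ j → Cw B (extend (v ∷ʳ k) k′) j i) (tropical′ i)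
        (let (j , 0<εc) = SignCoherent.nonzero (Invariant.coherent (proj₁ step′)) i
         in j , subst (λ D → 0# < pmR (Invariant.ε (proj₁ step′) i) * D j i) (sym C′≡) 0<εc)

lemma3p9 : (ℝ : RealField) → let open RealDefs ℝ in
    (B : Mat) → SkewSymmetrizable B → ClusterCyclic B →
    (v : List (Fin 3)) (k : Fin 3) → Reduced (v ∷ʳ k) →
    (ε : Fin 3 → PM) → TropSigns B (v ∷ʳ k) ε →
    ((s : Fin 3) → s ≢ k →
      pmR (ε s) * sgnR (Bw B (v ∷ʳ k) k s) ≡ - 1# → ε k ≢ ε s →
      ∀ j → 0# ≤ pmR (ε s) *
        ((∣ Bw B (v ∷ʳ k) s k * Bw B (v ∷ʳ k) k s ∣ - 2#) * Cw B (v ∷ʳ k) j k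
          + ∣ Bw B (v ∷ʳ k) s k ∣ * Cw B (v ∷ʳ k) j s))
    ×
    ((k' : Fin 3) → k' ≢ k →
      (ε' : Fin 3 → PM) → TropSigns B (extend (v ∷ʳ k) k') ε' →
      (∀ i j → pmR (ε i) * Cw B (v ∷ʳ k) j i ≤ pmR (ε' i) * Cw B (extend (v ∷ʳ k) k') j i)
      × ∃ λ i → ∃ λ j →
          pmR (ε i) * Cw B (v ∷ʳ k) j i ≢ pmR (ε' i) * Cw B (extend (v ∷ʳ k) k') j i)
lemma3p9 ℝ B _ cc v k red ε tropical =
  V-nonneg-at B cc v k red ε tropical , grows-at B cc v k red ε tropical
  where open Invariance ℝ
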